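{- For all integers $i,j\ge0$, the number of plane trees $T$ with $\mathsf{odd}(T)=0$, $\mathsf{oe}(T)=2i$ and $\mathsf{ee}(T)=2j+1$ equals $$\frac{1}{2j+1}\binom{2j+i}{i}\binom{2i+j-1}{j}.$$ Consequently, for every integer $n\ge1$, $$\frac{1}{2n+1}\binom{3n}{n}=\sum_{j=0}^{n-1}\frac{1}{2j+1}\binom{n+j}{2j}\binom{2n-j-1}{j}.$$
   Context: Plane trees are rooted trees in which the children of each node are linearly ordered (here of arbitrary finite size). The degree of a node is its number of children; its level is its distance from the root (root at level $0$). $\mathsf{odd}(T)$ is the number of odd-degree nodes; $\mathsf{oe}(T)$ (resp. $\mathsf{ee}(T)$) the number of even-degree nodes on odd (resp. even) levels. Binomial coefficients $\binom{a}{b}$ with $a<b$ (including $a=-1,b\ge1$) are $0$, and $\binom{ -1}{0}=1$. -}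

module Defs where

open import Data.Nat using (ℕ; zero; suc; _+_; _*_)
open import Data.Nat.Combinatorics using (_C_)
open import Data.Bool using (Bool; true; false; if_then_else_; _∧_; not)
open import Data.List using (List; []; _∷_; length; map; foldr; upTo)
open import Data.Rational using (ℚ; 0ℚ) renaming (_+_ to _+ℚ_)

data Tree : Set where
  node : List Tree → Tree

degree : Tree → ℕ
degree (node ts) = length ts

isEven : ℕ → Bool
isEven zero = true
isEven (suc n) = not (isEven n)

mutual
  countT : (ℕ → ℕ → Bool) → ℕ → Tree → ℕ
  countT P l (node ts) = (if P l (length ts) then 1 else 0) + countF P (suc l) ts

  countF : (ℕ → ℕ → Bool) → ℕ → List Tree → ℕ
  countF P l [] = 0
  countF P l (t ∷ ts) = countT P l t + countF P l ts

oddNodes : Tree → ℕ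
oddNodes = countT (λ _ d → not (isEven d)) 0

oe : Tree → ℕ
oe = countT (λ l d → isEven d ∧ not (isEven l)) 0

ee : Tree → ℕ
ee = countT (λ l d → isEven d ∧ isEven l) 0

-- binomial (a - 1) choose b, with the convention binom(-1,0)=1, binom(-1,b)=0 for b ≥ 1
binomPred : ℕ → ℕ → ℕ
binomPred zero zero = 1
binomPred zero (suc _) = 0
binomPred (suc a) b = a C b

sumℚ : ℕ → (ℕ → ℚ) → ℚ
sumℚ n f = foldr _+ℚ_ 0ℚ (map f (upTo n))

-- Cut a plane tree without odd-degree nodes into blocks, one per even-level node, consisting of
-- that node and its children, and label each block by the (even) degrees of those children. The
-- result is a tree whose preorder code is a Łukasiewicz word over blocks: ee counts the blocks,
-- oe counts their entries, and the entries add up to ee − 1. By the cycle lemma, among the 2j + 1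
-- rotations of a word of 2j + 1 blocks with entry sum 2j exactly one is a Łukasiewicz word, and
-- they are pairwise distinct; so (2j + 1) times the number of trees counts all such block words.
-- Halving block lengths and entries turns these into a weak composition of i into 2j + 1 parts
-- together with one of j into 2i parts. Applying the same argument to the plain Łukasiewicz code
-- of trees with 2n + 1 nodes and only even degrees gives C(3n, n) / (2n + 1), and splitting these
-- trees by ee = 2j + 1 yields the sum.

module Submission where

open import Defs
open import Data.Nat using (ℕ; zero; suc; _+_; _*_; _∸_; _≥_)
open import Data.Nat.Combinatorics using (_C_)
open import Data.Integer using (+_)
open import Data.Rational using (ℚ; _/_)
open import Data.Fin using (Fin)
open import Data.Product using (Σ; _×_)
open import Function.Bundles using (_↔_)
open import Relation.Binary.PropositionalEquality using (_≡_)

open import Data.Nat using (_≤_; _<_; z≤n; s≤s; s≤s⁻¹; z<s; s<s)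
open import Data.Nat.Properties
open import Algebra.Properties.CommutativeSemigroup +-commutativeSemigroup using () renaming (interchange to +-interchange)
open import Data.Nat.ListAction using (sum)
open import Data.Nat.ListAction.Properties using (sum-++)
open import Data.Nat.Combinatorics using (nCk+nC[k+1]≡[n+1]C[k+1]; nCk≡nC[n∸k])
open import Data.Nat.Combinatorics.Specification using (k>n⇒nCk≡0)
open import Data.Nat.Tactic.RingSolver using (solve-∀)
open import Data.Integer using () renaming (_+_ to _+ℤ_)
import Data.Integer.Properties as ℤ
open import Data.Rational using (0ℚ; toℚᵘ) renaming (_+_ to _+ℚ_)
open import Data.Rational.Properties using (fromℚᵘ-cong; toℚᵘ-injective; toℚᵘ-fromℚᵘ; toℚᵘ-homo-+)
open import Data.Rational.Unnormalised using (mkℚᵘ; *≡*) renaming (_+_ to _+ᵘ_)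
import Data.Rational.Unnormalised.Properties as ℚᵘ
open import Data.Bool using (Bool; true; false; not; _∧_; if_then_else_)
open import Data.Bool.Properties using (not-involutive; ∧-zeroʳ; ∧-identityʳ)
open import Data.List
  using (List; []; _∷_; _++_; [_]; length; map; take; drop; concatMap; foldr; applyUpTo; replicate; initLast; _∷ʳ′_)
open import Data.List.Properties
  using ( ++-assoc; ++-identityʳ; ∷-injective; ∷ʳ-injective; length-++; length-map; length-drop; length-take; length-replicate
        ; map-++; map-∘; map-id; take++drop≡id; take-all; take-[]; applyUpTo-∷ʳ; map-upTo)
open import Data.List.Relation.Unary.All using (All; []; _∷_)
open import Data.Maybe using (Maybe; just; nothing; _>>=_)
import Data.Maybe as Maybe
import Data.Maybe.Properties as Maybe
open import Data.Product using (_,_; proj₁; proj₂)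
open import Data.Product.Function.Dependent.Propositional using (Σ-↔)
open import Data.Product.Function.NonDependent.Propositional using (_×-↔_)
open import Data.Sum using (_⊎_; inj₁; inj₂)
open import Data.Sum.Function.Propositional using (_⊎-↔_)
open import Data.Empty using (⊥; ⊥-elim)
import Data.Fin as Fin
open import Data.Fin using (toℕ; fromℕ<)
open import Data.Fin.Properties using (toℕ-injective; toℕ-fromℕ<; toℕ<n; +↔⊎; *↔×)
open import Data.Fin.Permutation using (↔⇒≡)
open import Relation.Nullary using (¬_; Dec; yes; no; Irrelevant)
open import Axiom.UniquenessOfIdentityProofs using (module Decidable⇒UIP)
open import Function using (_∘_; _$_)
open import Function.Bundles using (mk↔ₛ′; Inverse)
open import Function.Properties.Inverse using (↔-refl; ↔-sym; ↔-trans)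
open import Relation.Binary.PropositionalEquality hiding ([_])

private variable A : Set

++-∷-split : ∀ (p : List A) d q a b → p ++ d ∷ q ≡ a ++ b →
  (Σ (List A) λ s → a ≡ p ++ d ∷ s × q ≡ s ++ b) ⊎ (Σ (List A) λ s → b ≡ s ++ d ∷ q × p ≡ a ++ s)
++-∷-split p       d q []      b eq   = inj₂ (p , sym eq , refl)
++-∷-split []      d q (x ∷ a) b refl = inj₁ (a , refl , refl)
++-∷-split (y ∷ p) d q (x ∷ a) b eq with refl , eq′ ← ∷-injective eq with ++-∷-split p d q a b eq′
... | inj₁ (s , refl , q≡) = inj₁ (s , refl , q≡)
... | inj₂ (s , b≡ , refl) = inj₂ (s , b≡ , refl)

++-≡-++ : ∀ (a b a′ b′ : List A) → a ++ b ≡ a′ ++ b′ →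
  Σ (List A) λ s → (a′ ≡ a ++ s × b ≡ s ++ b′) ⊎ (a ≡ a′ ++ s × b′ ≡ s ++ b)
++-≡-++ []      b a′       b′ eq = a′ , inj₁ (refl , eq)
++-≡-++ (x ∷ a) b []       b′ eq = x ∷ a , inj₂ (refl , sym eq)
++-≡-++ (x ∷ a) b (y ∷ a′) b′ eq with refl , eq′ ← ∷-injective eq with ++-≡-++ a b a′ b′ eq′
... | s , inj₁ (refl , b≡) = s , inj₁ (refl , b≡)
... | s , inj₂ (refl , b′≡) = s , inj₂ (refl , b′≡)

++≢[] : ∀ (b : List A) {a} → a ≢ [] → b ++ a ≢ []
++≢[] [] a≢[] = a≢[]

length-++-< : ∀ (b a : List A) → a ≢ [] → length b < length (b ++ a)
length-++-< []      (x ∷ a) _    = s≤s z≤n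
length-++-< []      []      a≢[] = ⊥-elim (a≢[] refl)
length-++-< (y ∷ b) a       a≢[] = s≤s (length-++-< b a a≢[])

length-swap : ∀ (a b : List A) → length (a ++ b) ≡ length (b ++ a)
length-swap a b = trans (length-++ a) (trans (+-comm (length a) (length b)) (sym (length-++ b)))

length-contract : ∀ (p : List A) x y z q → length (p ++ x ∷ y ∷ q) ≡ suc (length (p ++ z ∷ q))
length-contract p x y z q = trans (length-++ p) (trans (+-suc (length p) _) (cong suc (sym (length-++ p))))

length-replace-last : ∀ (m : List A) x y → length (m ++ [ x ]) ≡ length (m ++ [ y ])
length-replace-last m x y = trans (length-++ m) (sym (length-++ m))

take-length-++ : ∀ (a b : List A) → take (length a) (a ++ b) ≡ a
take-length-++ []      b = refl
take-length-++ (x ∷ a) b = cong (x ∷_) (take-length-++ a b)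

drop-length-++ : ∀ (a b : List A) → drop (length a) (a ++ b) ≡ b
drop-length-++ []      b = refl
drop-length-++ (x ∷ a) b = drop-length-++ a b

length-take-≤ : ∀ k (w : List A) → k ≤ length w → length (take k w) ≡ k
length-take-≤ k w k≤ = trans (length-take k w) (m≤n⇒m⊓n≡m k≤)

drop≢[] : ∀ k (w : List A) → k < length w → drop k w ≢ []
drop≢[] zero    (x ∷ w) _        ()
drop≢[] (suc k) (x ∷ w) (s≤s k<) = drop≢[] k w k<

take-+ : ∀ m n (xs : List A) → take (m + n) xs ≡ take m xs ++ take n (drop m xs)
take-+ zero    n xs       = refl
take-+ (suc m) n []       = sym (take-[] n)
take-+ (suc m) n (x ∷ xs) = cong (x ∷_) (take-+ m n xs)

applyUpTo-cong : ∀ n {f g : ℕ → A} → (∀ j → j < n → f j ≡ g j) → applyUpTo f n ≡ applyUpTo g n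
applyUpTo-cong zero    eq = refl
applyUpTo-cong (suc n) eq = cong₂ _∷_ (eq 0 z<s) (applyUpTo-cong n (λ j j<n → eq (suc j) (s<s j<n)))

sum-contract : ∀ p d q → sum (p ++ suc d ∷ 0 ∷ q) ≡ suc (sum (p ++ d ∷ q))
sum-contract p d q = trans (sum-++ p _) (trans (+-suc (sum p) _) (cong suc (sym (sum-++ p _))))

sum-increment-last : ∀ m d → sum (m ++ [ suc d ]) ≡ suc (sum (m ++ [ d ]))
sum-increment-last m d = trans (sum-++ m _) (trans (+-suc (sum m) _) (cong suc (sym (sum-++ m _))))

sum-applyUpTo-suc : ∀ n (g : ℕ → ℕ) → sum (applyUpTo g (suc n)) ≡ sum (applyUpTo g n) + g n
sum-applyUpTo-suc n g = trans (cong sum (sym (applyUpTo-∷ʳ g n)))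
  (trans (sum-++ (applyUpTo g n) [ g n ]) (cong (λ m → sum (applyUpTo g n) + m) (+-identityʳ (g n))))

-- Łukasiewicz words and the cycle lemma

pending : ℕ → List ℕ → Maybe ℕ
pending k       []      = just k
pending zero    (d ∷ w) = nothing
pending (suc k) (d ∷ w) = pending (d + k) w

Łukasiewicz : List ℕ → Set
Łukasiewicz w = pending 1 w ≡ just 0

pending-++ : ∀ k u v → pending k (u ++ v) ≡ (pending k u >>= λ m → pending m v)
pending-++ k       []      v = refl
pending-++ zero    (d ∷ u) v = refl
pending-++ (suc k) (d ∷ u) v = pending-++ (d + k) u v

pending-++⁻ : ∀ k u v {n} → pending k (u ++ v) ≡ just n →
              Σ ℕ λ m → pending k u ≡ just m × pending m v ≡ just n
pending-++⁻ k u v eq with pending k u | pending-++ k u v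
... | just m  | split = m , refl , trans (sym split) eq
... | nothing | split with () ← trans (sym eq) split

pending-+ : ∀ k w {m} t → pending k w ≡ just m → pending (k + t) w ≡ just (m + t)
pending-+ k       []      t refl = refl
pending-+ (suc k) (d ∷ w) t eq   = trans (cong (λ z → pending z w) (sym (+-assoc d k t))) (pending-+ (d + k) w t eq)

pending-sum : ∀ k w {m} → pending k w ≡ just m → k + sum w ≡ m + length w
pending-sum k       []      refl = refl
pending-sum (suc k) (d ∷ w) {m} eq = begin
  suc k + (d + sum w)  ≡⟨ cong suc (trans (sym (+-assoc k d (sum w))) (cong (_+ sum w) (+-comm k d))) ⟩
  suc (d + k + sum w)  ≡⟨ cong suc (pending-sum (d + k) w eq) ⟩
  suc (m + length w)   ≡⟨ sym (+-suc m (length w)) ⟩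
  m + suc (length w)   ∎
  where open ≡-Reasoning

pending-zero : ∀ w → pending 0 w ≡ just 0 → w ≡ []
pending-zero []      _  = refl
pending-zero (_ ∷ _) ()

pending-contract : ∀ k u d v → pending k (u ++ suc d ∷ 0 ∷ v) ≡ pending k (u ++ d ∷ v)
pending-contract zero    []      d v = refl
pending-contract (suc k) []      d v = refl
pending-contract zero    (e ∷ u) d v = refl
pending-contract (suc k) (e ∷ u) d v = pending-contract (e + k) u d v

rotation-invalid : ∀ a b → Łukasiewicz (a ++ b) → a ≢ [] → b ≢ [] → ¬ Łukasiewicz (b ++ a)
rotation-invalid a b ab-valid a≢[] b≢[] ba-valid
  with pending-++⁻ 1 a b ab-valid | pending-++⁻ 1 b a ba-valid
... | zero  , _ , b-empties | _                   = b≢[] (pending-zero b b-empties)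
... | suc m , _ , b-empties | z , b-run , a-empties =
  a≢[] (pending-zero a (subst (λ k → pending k a ≡ just 0) z≡0 a-empties))
  where
    z≡0 : z ≡ 0
    z≡0 = m+n≡0⇒m≡0 z (Maybe.just-injective (trans (sym (pending-+ 1 b m b-run)) b-empties))

record ValidRotation (Valid : List A → Set) (u : List A) : Set where
  constructor rotation
  field
    front back : List A
    split      : u ≡ front ++ back
    front≢[]   : front ≢ []
    valid      : Valid (back ++ front)

Łukasiewicz-expand : ∀ u d v → Łukasiewicz (u ++ d ∷ v) → Łukasiewicz (u ++ suc d ∷ 0 ∷ v)
Łukasiewicz-expand u d v = trans (pending-contract 1 u d v)

valid-rotation-expand : ∀ p d q → ValidRotation Łukasiewicz (p ++ d ∷ q) → ValidRotation Łukasiewicz (p ++ suc d ∷ 0 ∷ q)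
valid-rotation-expand p d q (rotation a b eq a≢[] valid) with ++-∷-split p d q a b eq
... | inj₁ (s , refl , refl) =
  rotation (p ++ suc d ∷ 0 ∷ s) b (sym (++-assoc p _ b)) (++≢[] p (λ ())) $
  subst Łukasiewicz (++-assoc b p _) (Łukasiewicz-expand (b ++ p) d s (subst Łukasiewicz (sym (++-assoc b p _)) valid))
... | inj₂ (s , refl , refl) =
  rotation a (s ++ suc d ∷ 0 ∷ q) (++-assoc a s _) a≢[] $
  subst Łukasiewicz (sym (++-assoc s _ a)) (Łukasiewicz-expand s d (q ++ a) (subst Łukasiewicz (++-assoc s _ a) valid))

valid-rotation-expand-wrap : ∀ m d → ValidRotation Łukasiewicz (m ++ [ d ]) → ValidRotation Łukasiewicz (0 ∷ m ++ [ suc d ])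
valid-rotation-expand-wrap m d (rotation a b eq a≢[] valid) with initLast b
... | [] rewrite ++-identityʳ a =
  rotation [ 0 ] (m ++ [ suc d ]) refl (λ ()) $
  subst Łukasiewicz (sym (++-assoc m _ _)) (Łukasiewicz-expand m d [] (subst Łukasiewicz (sym eq) valid))
... | b′ ∷ʳ′ e with refl , refl ← ∷ʳ-injective m (a ++ b′) (trans eq (sym (++-assoc a b′ [ e ]))) =
  rotation (0 ∷ a) (b′ ++ [ suc d ]) (cong (0 ∷_) (++-assoc a b′ _)) (λ ()) $
  subst Łukasiewicz (sym (++-assoc b′ _ _)) (Łukasiewicz-expand b′ d a (subst Łukasiewicz (++-assoc b′ _ a) valid))

data Descent : List ℕ → Set where
  flat     : ∀ {v} → sum v ≡ 0 → Descent v
  ends-up  : ∀ m d → Descent (m ++ [ suc d ])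
  descends : ∀ p d q → Descent (p ++ suc d ∷ 0 ∷ q)

descent : ∀ v → Descent v
descent [] = flat refl
descent (x ∷ v) with descent v
descent (zero ∷ v)          | flat e = flat e
descent (suc d ∷ [])        | flat e = ends-up [] d
descent (suc d ∷ zero ∷ v)  | flat e = descends [] d v
... | ends-up m d    = ends-up (x ∷ m) d
... | descends p d q = descends (x ∷ p) d q

data CyclicDescent : List ℕ → Set where
  descends : ∀ p d q → CyclicDescent (p ++ suc d ∷ 0 ∷ q)
  wraps    : ∀ m d → CyclicDescent (0 ∷ m ++ [ suc d ])
  flat     : ∀ {u} → sum u ≡ 0 → CyclicDescent u
  heavy    : ∀ {u} → length u ≤ sum u → CyclicDescent u

cyclic-descent : ∀ u → CyclicDescent u
cyclic-descent [] = flat refl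
cyclic-descent (zero ∷ v) with descent v
... | flat e         = flat e
... | ends-up m d    = wraps m d
... | descends p d q = descends (0 ∷ p) d q
cyclic-descent (suc d ∷ v) with cyclic-descent v
... | descends p e q = descends (suc d ∷ p) e q
... | wraps m e      = descends [] d (m ++ [ suc e ])
... | heavy le       = heavy (s≤s (≤-trans le (m≤n+m (sum v) d)))
cyclic-descent (suc d ∷ [])       | flat e = heavy (s≤s z≤n)
cyclic-descent (suc d ∷ zero ∷ v) | flat e = descends [] d v

flat-valid-rotation : ∀ u → sum u ≡ 0 → suc (sum u) ≡ length u → ValidRotation Łukasiewicz u
flat-valid-rotation []          e ()
flat-valid-rotation (x ∷ [])    e su = rotation [ x ] [] refl (λ ()) (cong just e)
flat-valid-rotation (x ∷ y ∷ w) e su with () ← trans (sym e) (suc-injective su)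

-- Contract a cyclically adjacent pair (suc d , 0), then lift a valid rotation of the shorter word.
Łukasiewicz-rotation : ∀ u → suc (sum u) ≡ length u → ValidRotation Łukasiewicz u
Łukasiewicz-rotation u = by-length (length u) u refl
  where
    by-length : ∀ n u → length u ≡ n → suc (sum u) ≡ length u → ValidRotation Łukasiewicz u
    by-length n u ln su with cyclic-descent u
    by-length n u ln su | flat e = flat-valid-rotation u e su
    by-length n u ln su | heavy le with () ← <⇒≱ (≤-reflexive su) le
    by-length zero .(p ++ suc d ∷ 0 ∷ q) ln su | descends p d q with () ← trans (sym ln) (length-contract p _ _ d q)
    by-length (suc n) .(p ++ suc d ∷ 0 ∷ q) ln su | descends p d q =
      valid-rotation-expand p d q (by-length n (p ++ d ∷ q)
        (suc-injective (trans (sym (length-contract p _ _ d q)) ln))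
        (suc-injective (trans (cong suc (sym (sum-contract p d q))) (trans su (length-contract p _ _ d q)))))
    by-length zero .(0 ∷ m ++ [ suc d ]) () su | wraps m d
    by-length (suc n) .(0 ∷ m ++ [ suc d ]) ln su | wraps m d =
      valid-rotation-expand-wrap m d (by-length n (m ++ [ d ])
        (trans (length-replace-last m d (suc d)) (suc-injective ln))
        (suc-injective (trans (cong suc (sym (sum-increment-last m d))) (trans su (cong suc (length-replace-last m (suc d) d))))))

-- Trees labelled by letters of given arity, and rotations of their codes

Maybe-ℕ-irrelevant : {a b : Maybe ℕ} → Irrelevant (a ≡ b)
Maybe-ℕ-irrelevant = Decidable⇒UIP.≡-irrelevant (Maybe.≡-dec _≟_)

module Labelled {X : Set} (arity : X → ℕ) where

  Valid : List X → Set
  Valid w = Łukasiewicz (map arity w)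

  data LTree : Set where
    node : (x : X) (ts : List LTree) → length ts ≡ arity x → LTree

  node-cong : ∀ {x x′ ts ts′ p p′} → x ≡ x′ → ts ≡ ts′ → node x ts p ≡ node x′ ts′ p′
  node-cong {p = p} {p′} refl refl = cong (node _ _) (≡-irrelevant p p′)

  mutual
    encode : LTree → List X
    encode (node x ts _) = x ∷ encodeForest ts

    encodeForest : List LTree → List X
    encodeForest []       = []
    encodeForest (t ∷ ts) = encode t ++ encodeForest ts

  encodeForest-++ : ∀ ts us → encodeForest (ts ++ us) ≡ encodeForest ts ++ encodeForest us
  encodeForest-++ []       us = refl
  encodeForest-++ (t ∷ ts) us =
    trans (cong (encode t ++_) (encodeForest-++ ts us)) (sym (++-assoc (encode t) (encodeForest ts) (encodeForest us)))

  run : ℕ → List X → Maybe ℕ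
  run k w = pending k (map arity w)

  mutual
    run-encode : ∀ t k w → run (suc k) (encode t ++ w) ≡ run k w
    run-encode (node x ts p) k w rewrite sym p = run-encodeForest ts k w

    run-encodeForest : ∀ ts k w → run (length ts + k) (encodeForest ts ++ w) ≡ run k w
    run-encodeForest []       k w = refl
    run-encodeForest (t ∷ ts) k w rewrite ++-assoc (encode t) (encodeForest ts) w =
      trans (run-encode t (length ts + k) (encodeForest ts ++ w)) (run-encodeForest ts k w)

  encode-valid : ∀ t → Valid (encode t)
  encode-valid t = trans (cong (run 1) (sym (++-identityʳ (encode t)))) (run-encode t 0 [])

  -- Decoding reads a word from right to left, keeping a stack of the subtrees read so far.

  pop : (n : ℕ) → List LTree → Maybe ((Σ (List LTree) λ l → length l ≡ n) × List LTree)
  pop zero    st       = just (([] , refl) , st)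
  pop (suc n) []       = nothing
  pop (suc n) (t ∷ st) = Maybe.map (λ { ((l , p) , r) → ((t ∷ l , cong suc p) , r) }) (pop n st)

  pop-++ : ∀ {n} ts st (p : length ts ≡ n) → pop n (ts ++ st) ≡ just ((ts , p) , st)
  pop-++ []       st refl = refl
  pop-++ (t ∷ ts) st refl rewrite pop-++ ts st refl = refl

  pop-≤ : ∀ n st → n ≤ length st →
    Σ (List LTree) λ l → Σ (length l ≡ n) λ p → Σ (List LTree) λ r → pop n st ≡ just ((l , p) , r) × l ++ r ≡ st
  pop-≤ zero    st       _        = [] , refl , st , refl , refl
  pop-≤ (suc n) (t ∷ st) (s≤s n≤) with pop-≤ n st n≤
  ... | l , p , r , popped , split rewrite popped = t ∷ l , cong suc p , r , refl , cong (t ∷_) split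

  push : X → List LTree → Maybe (List LTree)
  push x st = Maybe.map (λ { ((l , p) , r) → node x l p ∷ r }) (pop (arity x) st)

  decode : List X → Maybe (List LTree)
  decode []      = just []
  decode (x ∷ w) = decode w Maybe.>>= push x

  mutual
    decode-encode : ∀ t w st → decode w ≡ just st → decode (encode t ++ w) ≡ just (t ∷ st)
    decode-encode (node x ts p) w st eq rewrite decode-encodeForest ts w st eq | pop-++ ts st p = refl

    decode-encodeForest : ∀ ts w st → decode w ≡ just st → decode (encodeForest ts ++ w) ≡ just (ts ++ st)
    decode-encodeForest []       w st eq = eq
    decode-encodeForest (t ∷ ts) w st eq rewrite ++-assoc (encode t) (encodeForest ts) w =
      decode-encode t (encodeForest ts ++ w) (ts ++ st) (decode-encodeForest ts w st eq)

  decode-run : ∀ k w → run k w ≡ just 0 →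
    Σ (List LTree) λ ts → decode w ≡ just ts × length ts ≡ k × encodeForest ts ≡ w
  decode-run k       []      refl = [] , refl , refl , refl
  decode-run (suc k) (x ∷ w) eq with decode-run (arity x + k) w eq
  ... | st , decoded , len , enc with pop-≤ (arity x) st (subst (arity x ≤_) (sym len) (m≤m+n (arity x) k))
  ...   | l , p , r , popped , split rewrite decoded | popped = node x l p ∷ r , refl , length-r , encode-r
    where
      length-r : suc (length r) ≡ suc k
      length-r = cong suc (+-cancelˡ-≡ (arity x) (length r) k
        (trans (cong (_+ length r) (sym p)) (trans (sym (length-++ l)) (trans (cong length split) len))))
      encode-r : x ∷ encodeForest l ++ encodeForest r ≡ x ∷ w
      encode-r = cong (x ∷_) (trans (sym (encodeForest-++ l r)) (trans (cong encodeForest split) enc))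

  decodeValid : (w : List X) → Valid w → LTree
  decodeValid w v with decode-run 1 w v
  ... | t ∷ [] , _ = t

  LTree↔Valid : LTree ↔ Σ (List X) Valid
  LTree↔Valid = mk↔ₛ′ (λ t → encode t , encode-valid t) (λ (w , v) → decodeValid w v) encode-decode decode-encode′
    where
      encode-decode : ∀ wv → (encode (decodeValid (proj₁ wv) (proj₂ wv)) , encode-valid (decodeValid (proj₁ wv) (proj₂ wv))) ≡ wv
      encode-decode (w , v) with decode-run 1 w v
      ... | t ∷ [] , _ , _ , enc with trans (sym (++-identityʳ (encode t))) enc
      ...   | refl = cong (encode t ,_) (Maybe-ℕ-irrelevant _ _)
      decode-encode′ : ∀ t → decodeValid (encode t) (encode-valid t) ≡ t
      decode-encode′ t with decode-run 1 (encode t) (encode-valid t)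
      ... | t′ ∷ [] , decoded , _ with trans (sym decoded)
              (subst (λ w → decode w ≡ just (t ∷ [])) (++-identityʳ (encode t)) (decode-encode t [] [] refl))
      ...   | refl = refl

  weight : List X → ℕ
  weight w = sum (map arity w)

  Balanced : List X → Set
  Balanced u = suc (weight u) ≡ length u

  valid⇒balanced : ∀ w → Valid w → Balanced w
  valid⇒balanced w v = trans (pending-sum 1 (map arity w) v) (length-map arity w)

  balanced-rotate : ∀ a b → Balanced (a ++ b) → Balanced (b ++ a)
  balanced-rotate a b bal = trans (cong suc (weight-swap b a)) (trans bal (length-swap a b))
    where
      weight-swap : ∀ a b → weight (a ++ b) ≡ weight (b ++ a)
      weight-swap a b = begin
        sum (map arity (a ++ b))           ≡⟨ cong sum (map-++ arity a b) ⟩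
        sum (map arity a ++ map arity b)   ≡⟨ sum-++ (map arity a) _ ⟩
        weight a + weight b                ≡⟨ +-comm (weight a) _ ⟩
        weight b + weight a                ≡⟨ sum-++ (map arity b) _ ⟨
        sum (map arity b ++ map arity a)   ≡⟨ cong sum (map-++ arity b a) ⟨
        sum (map arity (b ++ a))           ∎
        where open ≡-Reasoning

  private
    map-++⁻ : ∀ u a b → map arity u ≡ a ++ b →
      Σ (List X) λ u₁ → Σ (List X) λ u₂ → u ≡ u₁ ++ u₂ × map arity u₁ ≡ a × map arity u₂ ≡ b
    map-++⁻ u       []      b eq = [] , u , refl , refl , eq
    map-++⁻ (x ∷ u) (y ∷ a) b eq with refl , eq′ ← ∷-injective eq with map-++⁻ u a b eq′
    ... | u₁ , u₂ , refl , refl , refl = x ∷ u₁ , u₂ , refl , refl , refl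

    map≢[] : ∀ (u : List X) → u ≢ [] → map arity u ≢ []
    map≢[] []      u≢[] _ = u≢[] refl

    valid-++ : ∀ a b → Valid (a ++ b) → Łukasiewicz (map arity a ++ map arity b)
    valid-++ a b = subst Łukasiewicz (map-++ arity a b)

    Valid-rotation-invalid : ∀ a b → Valid (a ++ b) → a ≢ [] → b ≢ [] → ¬ Valid (b ++ a)
    Valid-rotation-invalid a b ab a≢[] b≢[] ba =
      rotation-invalid (map arity a) (map arity b) (valid-++ a b ab) (map≢[] a a≢[]) (map≢[] b b≢[]) (valid-++ b a ba)

  valid-rotation : ∀ u → Balanced u → ValidRotation Valid u
  valid-rotation u bal with rotation a b eq a≢[] v ← Łukasiewicz-rotation (map arity u) (trans bal (sym (length-map arity u)))
                       with u₁ , u₂ , refl , refl , refl ← map-++⁻ u a b eq =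
    rotation u₁ u₂ refl (λ { refl → a≢[] refl }) (subst Łukasiewicz (sym (map-++ arity u₂ u₁)) v)

  rotation-unique : ∀ a b a′ b′ → a ++ b ≡ a′ ++ b′ → a ≢ [] → a′ ≢ [] →
    Valid (b ++ a) → Valid (b′ ++ a′) → a ≡ a′ × b ≡ b′
  rotation-unique a b a′ b′ eq a≢[] a′≢[] v v′ with ++-≡-++ a b a′ b′ eq
  ... | [] , inj₁ (refl , refl) = sym (++-identityʳ a) , refl
  ... | [] , inj₂ (refl , refl) = ++-identityʳ a′ , refl
  ... | x ∷ s , inj₁ (refl , refl) = ⊥-elim (Valid-rotation-invalid (b′ ++ a) (x ∷ s)
          (subst Valid (sym (++-assoc b′ a _)) v′) (++≢[] b′ a≢[]) (λ ()) (subst Valid (++-assoc (x ∷ s) b′ a) v))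
  ... | x ∷ s , inj₂ (refl , refl) = ⊥-elim (Valid-rotation-invalid (b ++ a′) (x ∷ s)
          (subst Valid (sym (++-assoc b a′ _)) v) (++≢[] b a′≢[]) (λ ()) (subst Valid (++-assoc (x ∷ s) b a′) v′))

  -- A balanced word of length E has E distinct rotations, exactly one of which is valid.
  module Rotations (Q : List X → Set) (Q-rotate : ∀ a b → Q (a ++ b) → Q (b ++ a))
                   (Q-irrelevant : ∀ {w} → Irrelevant (Q w)) (E : ℕ) where

    ValidWord : Set
    ValidWord = Σ (List X) λ w → Valid w × length w ≡ E × Q w

    BalancedWord : Set
    BalancedWord = Σ (List X) λ u → Balanced u × length u ≡ E × Q u

    private
      length-rotate : ∀ (a b : List X) → length (a ++ b) ≡ E → length (b ++ a) ≡ E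
      length-rotate a b l = trans (sym (length-swap a b)) l

      rotate-at : ∀ {P : List X → Set} → (∀ a b → P (a ++ b) → P (b ++ a)) → ∀ k w → P w → P (drop k w ++ take k w)
      rotate-at {P} rot k w p = rot (take k w) (drop k w) (subst P (sym (take++drop≡id k w)) p)

    rotate : ValidWord × Fin E → BalancedWord
    rotate ((w , v , l , q) , r) =
      drop k w ++ take k w , rotate-at balanced-rotate k w (valid⇒balanced w v) ,
      rotate-at length-rotate k w l , rotate-at Q-rotate k w q
      where k = toℕ r

    unrotate : BalancedWord → ValidWord × Fin E
    unrotate (u , bal , l , q) =
      (back ++ front , valid , rotated-length , Q-rotate front back (subst Q split q)) , fromℕ< back<E
      where
        open ValidRotation (valid-rotation u bal)
        rotated-length : length (back ++ front) ≡ E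
        rotated-length = length-rotate front back (subst (λ w → length w ≡ E) split l)
        back<E : length back < E
        back<E = subst (length back <_) rotated-length (length-++-< back front front≢[])

    BalancedWord-≡ : ∀ {u u′ b b′ l l′ q q′} → u ≡ u′ → _≡_ {A = BalancedWord} (u , b , l , q) (u′ , b′ , l′ , q′)
    BalancedWord-≡ {b = b} {b′} {l} {l′} {q} {q′} refl
      rewrite ≡-irrelevant b b′ | ≡-irrelevant l l′ | Q-irrelevant q q′ = refl

    private
      ValidWord×Fin-≡ : ∀ {w w′ v v′ l l′ q q′} {r r′ : Fin E} → w ≡ w′ → toℕ r ≡ toℕ r′ →
                        _≡_ {A = ValidWord × Fin E} ((w , v , l , q) , r) ((w′ , v′ , l′ , q′) , r′)
      ValidWord×Fin-≡ {v = v} {v′} {l} {l′} {q} {q′} refl r≡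
        rewrite Maybe-ℕ-irrelevant v v′ | ≡-irrelevant l l′ | Q-irrelevant q q′ | toℕ-injective r≡ = refl

    unrotate-rotate : ∀ x → unrotate (rotate x) ≡ x
    unrotate-rotate x@((w , v , l , q) , r) =
      ValidWord×Fin-≡ (trans (cong₂ _++_ back≡ front≡) (take++drop≡id k w))
                      (trans (toℕ-fromℕ< _) (trans (cong length back≡) (length-take-≤ k w (<⇒≤ k<))))
      where
        k = toℕ r
        k< : k < length w
        k< = subst (k <_) (sym l) (toℕ<n r)
        open ValidRotation (valid-rotation (proj₁ (rotate x)) (proj₁ (proj₂ (rotate x))))
        unique = rotation-unique front back (drop k w) (take k w) (sym split) front≢[] (drop≢[] k w k<)
                   valid (subst Valid (sym (take++drop≡id k w)) v)
        front≡ = proj₁ unique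
        back≡ = proj₂ unique

    rotate-unrotate : ∀ y → rotate (unrotate y) ≡ y
    rotate-unrotate (u , bal , l , q) = BalancedWord-≡ (trans (cong₂ _++_ drop≡ take≡) (sym split))
      where
        open ValidRotation (valid-rotation u bal)
        k≡ : toℕ (fromℕ< _) ≡ length back
        k≡ = toℕ-fromℕ< _
        drop≡ : drop (toℕ (proj₂ (unrotate (u , bal , l , q)))) (back ++ front) ≡ front
        drop≡ = trans (cong (λ k → drop k (back ++ front)) k≡) (drop-length-++ back front)
        take≡ : take (toℕ (proj₂ (unrotate (u , bal , l , q)))) (back ++ front) ≡ back
        take≡ = trans (cong (λ k → take k (back ++ front)) k≡) (take-length-++ back front)

    ΣLTree↔ValidWord : (∀ {w} → Q w → length w ≡ E) → Σ LTree (λ t → Q (encode t)) ↔ ValidWord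
    ΣLTree↔ValidWord length-E = ↔-trans (Σ-↔ LTree↔Valid ↔-refl)
      (mk↔ₛ′ (λ ((w , v) , q) → w , v , length-E q , q) (λ (w , v , _ , q) → (w , v) , q)
             (λ (w , v , l , q) → cong (λ l → w , v , l , q) (≡-irrelevant _ _)) (λ _ → refl))

    rotations↔ : (ValidWord × Fin E) ↔ BalancedWord
    rotations↔ = mk↔ₛ′ rotate unrotate rotate-unrotate unrotate-rotate

-- Finite types and weak compositions

Σ-Fin-suc↔⊎ : ∀ {n} (P : Fin (suc n) → Set) → Σ (Fin (suc n)) P ↔ (P Fin.zero ⊎ Σ (Fin n) (P ∘ Fin.suc))
Σ-Fin-suc↔⊎ P = mk↔ₛ′ split join
  (λ { (inj₁ p) → refl ; (inj₂ (k , p)) → refl }) (λ { (Fin.zero , p) → refl ; (Fin.suc k , p) → refl })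
  where
    split : Σ _ P → _
    split (Fin.zero  , p) = inj₁ p
    split (Fin.suc k , p) = inj₂ (k , p)
    join : _ → Σ _ P
    join (inj₁ p)       = Fin.zero , p
    join (inj₂ (k , p)) = Fin.suc k , p

Σ-Fin↔Fin-sum : ∀ n (g : ℕ → ℕ) → Σ (Fin n) (λ k → Fin (g (toℕ k))) ↔ Fin (sum (applyUpTo g n))
Σ-Fin↔Fin-sum zero    g = mk↔ₛ′ (λ ()) (λ ()) (λ ()) (λ ())
Σ-Fin↔Fin-sum (suc n) g =
  ↔-trans (Σ-Fin-suc↔⊎ _) (↔-trans (↔-refl ⊎-↔ Σ-Fin↔Fin-sum n (g ∘ suc)) (↔-sym +↔⊎))

Dec↔Fin : ∀ {P : Set} → Dec P → Irrelevant P → Σ ℕ λ n → P ↔ Fin n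
Dec↔Fin (yes p) irr = 1 , mk↔ₛ′ (λ _ → Fin.zero) (λ _ → p) (λ { Fin.zero → refl ; (Fin.suc ()) }) (irr p)
Dec↔Fin (no ¬p) irr = 0 , mk↔ₛ′ (λ p → ⊥-elim (¬p p)) (λ ()) (λ ()) (λ p → ⊥-elim (¬p p))

Σ-Fin-Dec↔Fin : ∀ M (P : Fin M → Set) → (∀ k → Dec (P k)) → (∀ {k} → Irrelevant (P k)) → Σ ℕ λ N → Σ (Fin M) P ↔ Fin N
Σ-Fin-Dec↔Fin zero    P dec irr = 0 , mk↔ₛ′ (λ ()) (λ ()) (λ ()) (λ ())
Σ-Fin-Dec↔Fin (suc M) P dec irr
  with N₀ , P₀↔ ← Dec↔Fin (dec Fin.zero) irr
     | N , rest↔ ← Σ-Fin-Dec↔Fin M (P ∘ Fin.suc) (dec ∘ Fin.suc) irr =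
  N₀ + N , ↔-trans (Σ-Fin-suc↔⊎ P) (↔-trans (P₀↔ ⊎-↔ rest↔) (↔-sym +↔⊎))

-- A is in bijection with the elements of Fin M whose second coordinate is zero.
×-Fin↔Fin⇒↔Fin : ∀ e M → (A × Fin (suc e)) ↔ Fin M → Σ ℕ λ N → (A ↔ Fin N) × N * suc e ≡ M
×-Fin↔Fin⇒↔Fin {A} e M φ = N , A↔Fin , ↔⇒≡ (↔-trans *↔× (↔-trans (↔-sym A↔Fin ×-↔ ↔-refl) φ))
  where
    open Inverse φ
    P : Fin M → Set
    P k = proj₂ (from k) ≡ Fin.zero
    P-irrelevant : ∀ {k} → Irrelevant (P k)
    P-irrelevant = Decidable⇒UIP.≡-irrelevant Fin._≟_
    A↔ΣP : A ↔ Σ (Fin M) P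
    A↔ΣP = mk↔ₛ′ (λ a → to (a , Fin.zero) , cong proj₂ (strictlyInverseʳ (a , Fin.zero)))
                 (λ (k , _) → proj₁ (from k))
                 (λ { (k , p) → Σ-irrelevant (trans (cong (λ z → to (proj₁ (from k) , z)) (sym p)) (strictlyInverseˡ k)) })
                 (λ a → cong proj₁ (strictlyInverseʳ (a , Fin.zero)))
      where
        Σ-irrelevant : ∀ {k k′} {p : P k} {p′ : P k′} → k ≡ k′ → (k , p) ≡ (k′ , p′)
        Σ-irrelevant {p = p} {p′} refl = cong (_ ,_) (P-irrelevant p p′)
    ΣP↔Fin = Σ-Fin-Dec↔Fin M P (λ k → proj₂ (from k) Fin.≟ Fin.zero) P-irrelevant
    N = proj₁ ΣP↔Fin
    A↔Fin : A ↔ Fin N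
    A↔Fin = ↔-trans A↔ΣP (proj₂ ΣP↔Fin)

Composition : ℕ → ℕ → Set
Composition m s = Σ (List ℕ) λ l → length l ≡ m × sum l ≡ s

Composition-≡ : ∀ {m s l l′} {p : length l ≡ m} {p′} {q : sum l ≡ s} {q′} → l ≡ l′ →
                _≡_ {A = Composition m s} (l , p , q) (l′ , p′ , q′)
Composition-≡ {p = p} {p′} {q} {q′} refl = cong₂ (λ a b → _ , a , b) (≡-irrelevant p p′) (≡-irrelevant q q′)

compositionCount : ℕ → ℕ → ℕ
compositionCount zero    zero    = 1
compositionCount zero    (suc s) = 0
compositionCount (suc m) zero    = 1
compositionCount (suc m) (suc s) = compositionCount m (suc s) + compositionCount (suc m) s

Composition-pascal : ∀ m s → Composition (suc m) (suc s) ↔ (Composition m (suc s) ⊎ Composition (suc m) s)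
Composition-pascal m s = mk↔ₛ′ split join split-join join-split
  where
    split : Composition (suc m) (suc s) → Composition m (suc s) ⊎ Composition (suc m) s
    split (zero  ∷ l , p , q) = inj₁ (l , suc-injective p , q)
    split (suc a ∷ l , p , q) = inj₂ (a ∷ l , p , suc-injective q)
    join : Composition m (suc s) ⊎ Composition (suc m) s → Composition (suc m) (suc s)
    join (inj₁ (l , p , q))     = zero ∷ l , cong suc p , q
    join (inj₂ (a ∷ l , p , q)) = suc a ∷ l , p , cong suc q
    split-join : ∀ y → split (join y) ≡ y
    split-join (inj₁ (l , p , q))     = cong inj₁ (Composition-≡ refl)
    split-join (inj₂ (a ∷ l , p , q)) = cong inj₂ (Composition-≡ refl)
    join-split : ∀ x → join (split x) ≡ x
    join-split (zero  ∷ l , p , q) = Composition-≡ refl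
    join-split (suc a ∷ l , p , q) = Composition-≡ refl

Composition↔Fin : ∀ m s → Composition m s ↔ Fin (compositionCount m s)
Composition↔Fin zero zero =
  mk↔ₛ′ (λ _ → Fin.zero) (λ _ → [] , refl , refl) (λ { Fin.zero → refl ; (Fin.suc ()) }) (λ { ([] , refl , refl) → refl })
Composition↔Fin zero (suc s) = mk↔ₛ′ (λ { ([] , refl , ()) }) (λ ()) (λ ()) (λ { ([] , refl , ()) })
Composition↔Fin (suc m) zero =
  mk↔ₛ′ (λ _ → Fin.zero) (λ _ → replicate (suc m) 0 , cong suc (length-replicate m) , sum-replicate-0 m)
        (λ { Fin.zero → refl ; (Fin.suc ()) }) (λ { (l , p , q) → Composition-≡ (sym (trans (zeros l q) (cong (λ n → replicate n 0) p))) })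
  where
    sum-replicate-0 : ∀ n → sum (replicate n 0) ≡ 0
    sum-replicate-0 zero    = refl
    sum-replicate-0 (suc n) = sum-replicate-0 n
    zeros : ∀ l → sum l ≡ 0 → l ≡ replicate (length l) 0
    zeros []      _ = refl
    zeros (x ∷ l) e rewrite m+n≡0⇒m≡0 x e = cong (0 ∷_) (zeros l (m+n≡0⇒n≡0 x e))
Composition↔Fin (suc m) (suc s) =
  ↔-trans (Composition-pascal m s) (↔-trans (Composition↔Fin m (suc s) ⊎-↔ Composition↔Fin (suc m) s) (↔-sym +↔⊎))

compositionCount≡binomPred : ∀ m s → compositionCount m s ≡ binomPred (m + s) s
compositionCount≡binomPred zero    zero    = refl
compositionCount≡binomPred zero    (suc s) = sym (k>n⇒nCk≡0 (n<1+n s))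
compositionCount≡binomPred (suc m) zero    = refl
compositionCount≡binomPred (suc m) (suc s) = begin
  compositionCount m (suc s) + compositionCount (suc m) s  ≡⟨ cong₂ _+_ (compositionCount≡binomPred m (suc s)) (compositionCount≡binomPred (suc m) s) ⟩
  binomPred (m + suc s) (suc s) + (m + s) C s              ≡⟨ cong (λ n → binomPred n (suc s) + (m + s) C s) (+-suc m s) ⟩
  (m + s) C suc s + (m + s) C s                            ≡⟨ +-comm ((m + s) C suc s) _ ⟩
  (m + s) C s + (m + s) C suc s                            ≡⟨ nCk+nC[k+1]≡[n+1]C[k+1] (m + s) s ⟩
  suc (m + s) C suc s                                      ≡⟨ cong (_C suc s) (+-suc m s) ⟨
  (m + suc s) C suc s                                      ∎
  where open ≡-Reasoning

-- Plane trees as trees of blocks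

Block : Set
Block = List ℕ

module B = Labelled {Block} sum
open B using () renaming (LTree to BlockTree)

-- An even-level node together with its children becomes one block node, labelled by the degrees
-- of those children; its subtrees are the (block trees of its) grandchildren.
mutual
  toBlocks : Tree → BlockTree
  toBlocks (node cs) = B.node (map degree cs) (grandchildren cs) (length-grandchildren cs)

  toBlocksForest : List Tree → List BlockTree
  toBlocksForest []       = []
  toBlocksForest (t ∷ ts) = toBlocks t ∷ toBlocksForest ts

  grandchildren : List Tree → List BlockTree
  grandchildren []             = []
  grandchildren (node gs ∷ cs) = toBlocksForest gs ++ grandchildren cs

  length-toBlocksForest : ∀ ts → length (toBlocksForest ts) ≡ length ts
  length-toBlocksForest []       = refl
  length-toBlocksForest (t ∷ ts) = cong suc (length-toBlocksForest ts)

  length-grandchildren : ∀ cs → length (grandchildren cs) ≡ sum (map degree cs)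
  length-grandchildren []             = refl
  length-grandchildren (node gs ∷ cs) =
    trans (length-++ (toBlocksForest gs)) (cong₂ _+_ (length-toBlocksForest gs) (length-grandchildren cs))

regroup : List ℕ → List Tree → List Tree
regroup []       ts = []
regroup (d ∷ ds) ts = node (take d ts) ∷ regroup ds (drop d ts)

mutual
  fromBlocks : BlockTree → Tree
  fromBlocks (B.node ds ts _) = node (regroup ds (fromBlocksForest ts))

  fromBlocksForest : List BlockTree → List Tree
  fromBlocksForest []       = []
  fromBlocksForest (t ∷ ts) = fromBlocks t ∷ fromBlocksForest ts

fromBlocksForest-++ : ∀ ts us → fromBlocksForest (ts ++ us) ≡ fromBlocksForest ts ++ fromBlocksForest us
fromBlocksForest-++ []       us = refl
fromBlocksForest-++ (t ∷ ts) us = cong (fromBlocks t ∷_) (fromBlocksForest-++ ts us)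

toBlocksForest-++ : ∀ ts us → toBlocksForest (ts ++ us) ≡ toBlocksForest ts ++ toBlocksForest us
toBlocksForest-++ []       us = refl
toBlocksForest-++ (t ∷ ts) us = cong (toBlocks t ∷_) (toBlocksForest-++ ts us)

length-fromBlocksForest : ∀ ts → length (fromBlocksForest ts) ≡ length ts
length-fromBlocksForest []       = refl
length-fromBlocksForest (t ∷ ts) = cong suc (length-fromBlocksForest ts)

concatChildren : List Tree → List Tree
concatChildren []             = []
concatChildren (node gs ∷ cs) = gs ++ concatChildren cs

regroup-concatChildren : ∀ cs → regroup (map degree cs) (concatChildren cs) ≡ cs
regroup-concatChildren []             = refl
regroup-concatChildren (node gs ∷ cs) =
  cong₂ (λ g c → node g ∷ c) (take-length-++ gs (concatChildren cs))
    (trans (cong (regroup (map degree cs)) (drop-length-++ gs (concatChildren cs))) (regroup-concatChildren cs))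

mutual
  fromBlocks-toBlocks : ∀ t → fromBlocks (toBlocks t) ≡ t
  fromBlocks-toBlocks (node cs) =
    cong node (trans (cong (regroup (map degree cs)) (fromBlocks-grandchildren cs)) (regroup-concatChildren cs))

  fromBlocks-toBlocksForest : ∀ ts → fromBlocksForest (toBlocksForest ts) ≡ ts
  fromBlocks-toBlocksForest []       = refl
  fromBlocks-toBlocksForest (t ∷ ts) = cong₂ _∷_ (fromBlocks-toBlocks t) (fromBlocks-toBlocksForest ts)

  fromBlocks-grandchildren : ∀ cs → fromBlocksForest (grandchildren cs) ≡ concatChildren cs
  fromBlocks-grandchildren []             = refl
  fromBlocks-grandchildren (node gs ∷ cs) =
    trans (fromBlocksForest-++ (toBlocksForest gs) (grandchildren cs))
          (cong₂ _++_ (fromBlocks-toBlocksForest gs) (fromBlocks-grandchildren cs))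

grandchildren-regroup : ∀ ds ts → grandchildren (regroup ds ts) ≡ toBlocksForest (take (sum ds) ts)
grandchildren-regroup []       ts = refl
grandchildren-regroup (d ∷ ds) ts =
  trans (cong (toBlocksForest (take d ts) ++_) (grandchildren-regroup ds (drop d ts)))
    (trans (sym (toBlocksForest-++ (take d ts) (take (sum ds) (drop d ts)))) (cong toBlocksForest (sym (take-+ d (sum ds) ts))))

degrees-regroup : ∀ ds ts → sum ds ≤ length ts → map degree (regroup ds ts) ≡ ds
degrees-regroup []       ts _  = refl
degrees-regroup (d ∷ ds) ts le = cong₂ _∷_ (length-take-≤ d ts (≤-trans (m≤m+n d (sum ds)) le))
  (degrees-regroup ds (drop d ts) (subst (sum ds ≤_) (sym (length-drop d ts))
    (subst (_≤ length ts ∸ d) (m+n∸m≡n d (sum ds)) (∸-monoˡ-≤ d le))))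

mutual
  toBlocks-fromBlocks : ∀ t → toBlocks (fromBlocks t) ≡ t
  toBlocks-fromBlocks (B.node ds ts p) = B.node-cong
    (degrees-regroup ds (fromBlocksForest ts) (≤-reflexive (sym length≡)))
    (trans (grandchildren-regroup ds (fromBlocksForest ts))
      (trans (cong toBlocksForest (take-all (sum ds) (fromBlocksForest ts) (≤-reflexive length≡)))
        (toBlocks-fromBlocksForest ts)))
    where length≡ = trans (length-fromBlocksForest ts) p

  toBlocks-fromBlocksForest : ∀ ts → toBlocksForest (fromBlocksForest ts) ≡ ts
  toBlocks-fromBlocksForest []       = refl
  toBlocks-fromBlocksForest (t ∷ ts) = cong₂ _∷_ (toBlocks-fromBlocks t) (toBlocks-fromBlocksForest ts)

Tree↔BlockTree : Tree ↔ BlockTree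
Tree↔BlockTree = mk↔ₛ′ toBlocks fromBlocks toBlocks-fromBlocks fromBlocks-toBlocks

indicator : Bool → ℕ
indicator b = if b then 1 else 0

Periodic : (ℕ → ℕ → Bool) → Set
Periodic P = ∀ l d → P (suc (suc l)) d ≡ P l d

mutual
  countT-periodic : ∀ P → Periodic P → ∀ l t → countT P (suc (suc l)) t ≡ countT P l t
  countT-periodic P per l (node ts) = cong₂ _+_ (cong indicator (per l (length ts))) (countF-periodic P per (suc l) ts)

  countF-periodic : ∀ P → Periodic P → ∀ l ts → countF P (suc (suc l)) ts ≡ countF P l ts
  countF-periodic P per l []       = refl
  countF-periodic P per l (t ∷ ts) = cong₂ _+_ (countT-periodic P per l t) (countF-periodic P per l ts)

-- A block at level l stands for one node at level l and its children at level l + 1.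
blockCount₁ : (ℕ → ℕ → Bool) → ℕ → Block → ℕ
blockCount₁ P l ds = indicator (P l (length ds)) + sum (map (λ d → indicator (P (suc l) d)) ds)

blockCount : (ℕ → ℕ → Bool) → ℕ → List Block → ℕ
blockCount P l w = sum (map (blockCount₁ P l) w)

blockCount-++ : ∀ P l u v → blockCount P l (u ++ v) ≡ blockCount P l u + blockCount P l v
blockCount-++ P l u v = trans (cong sum (map-++ (blockCount₁ P l) u v)) (sum-++ (map (blockCount₁ P l) u) _)

blockCount-swap : ∀ P l u v → blockCount P l (u ++ v) ≡ blockCount P l (v ++ u)
blockCount-swap P l u v = trans (blockCount-++ P l u v) (trans (+-comm (blockCount P l u) _) (sym (blockCount-++ P l v u)))

-- Periodicity is needed because a grandchild at level l + 2 is encoded as a block at level l.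
mutual
  countT≡blockCount : ∀ P → Periodic P → ∀ l t → countT P l t ≡ blockCount P l (B.encode (toBlocks t))
  countT≡blockCount P per l (node cs) = begin
    indicator (P l (length cs)) + countF P (suc l) cs
      ≡⟨ cong₂ _+_ (cong (λ n → indicator (P l n)) (sym (length-map degree cs))) (countChildren≡blockCount P per l cs) ⟩
    indicator (P l (length (map degree cs))) + (childCount + rest)
      ≡⟨ +-assoc (indicator (P l (length (map degree cs)))) childCount rest ⟨
    indicator (P l (length (map degree cs))) + childCount + rest
      ≡⟨ cong (λ n → indicator (P l (length (map degree cs))) + n + rest) (cong sum (map-∘ cs)) ⟩
    blockCount₁ P l (map degree cs) + rest
      ∎
    where
      open ≡-Reasoning
      childCount = sum (map (λ c → indicator (P (suc l) (degree c))) cs)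
      rest = blockCount P l (B.encodeForest (grandchildren cs))

  countChildren≡blockCount : ∀ P → Periodic P → ∀ l cs →
    countF P (suc l) cs ≡ sum (map (λ c → indicator (P (suc l) (degree c))) cs) + blockCount P l (B.encodeForest (grandchildren cs))
  countChildren≡blockCount P per l []             = refl
  countChildren≡blockCount P per l (node gs ∷ cs) = begin
    (root + countF P (suc (suc l)) gs) + countF P (suc l) cs
      ≡⟨ cong₂ _+_ (cong (_+_ root) (trans (countF-periodic P per l gs) (countF≡blockCount P per l gs)))
                   (countChildren≡blockCount P per l cs) ⟩
    (root + blockCount P l (B.encodeForest (toBlocksForest gs))) + (childCount + rest)
      ≡⟨ +-interchange root _ childCount rest ⟩
    (root + childCount) + (blockCount P l (B.encodeForest (toBlocksForest gs)) + rest)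
      ≡⟨ cong (_+_ (root + childCount)) (sym (blockCount-++ P l (B.encodeForest (toBlocksForest gs)) _)) ⟩
    (root + childCount) + blockCount P l (B.encodeForest (toBlocksForest gs) ++ B.encodeForest (grandchildren cs))
      ≡⟨ cong (λ w → (root + childCount) + blockCount P l w) (B.encodeForest-++ (toBlocksForest gs) (grandchildren cs)) ⟨
    (root + childCount) + blockCount P l (B.encodeForest (grandchildren (node gs ∷ cs)))
      ∎
    where
      open ≡-Reasoning
      root = indicator (P (suc l) (length gs))
      childCount = sum (map (λ c → indicator (P (suc l) (degree c))) cs)
      rest = blockCount P l (B.encodeForest (grandchildren cs))

  countF≡blockCount : ∀ P → Periodic P → ∀ l ts → countF P l ts ≡ blockCount P l (B.encodeForest (toBlocksForest ts))
  countF≡blockCount P per l []       = refl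
  countF≡blockCount P per l (t ∷ ts) =
    trans (cong₂ _+_ (countT≡blockCount P per l t) (countF≡blockCount P per l ts))
          (sym (blockCount-++ P l (B.encode (toBlocks t)) _))

-- Trees without odd-degree nodes, by oe and ee

oddDegree evenDegreeOddLevel evenDegreeEvenLevel : ℕ → ℕ → Bool
oddDegree           = λ _ d → not (isEven d)
evenDegreeOddLevel  = λ l d → isEven d ∧ not (isEven l)
evenDegreeEvenLevel = λ l d → isEven d ∧ isEven l

isEven-+2 : ∀ l → isEven (suc (suc l)) ≡ isEven l
isEven-+2 l = not-involutive (isEven l)

oddDegree-periodic : Periodic oddDegree
oddDegree-periodic l d = refl

evenDegreeOddLevel-periodic : Periodic evenDegreeOddLevel
evenDegreeOddLevel-periodic l d = cong (λ e → isEven d ∧ not e) (isEven-+2 l)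

evenDegreeEvenLevel-periodic : Periodic evenDegreeEvenLevel
evenDegreeEvenLevel-periodic l d = cong (isEven d ∧_) (isEven-+2 l)

double : ℕ → ℕ
double zero    = zero
double (suc k) = suc (suc (double k))

half : ℕ → ℕ
half zero          = zero
half (suc zero)    = zero
half (suc (suc n)) = suc (half n)

double≡2* : ∀ k → double k ≡ 2 * k
double≡2* zero    = refl
double≡2* (suc k) = cong suc (trans (cong suc (double≡2* k)) (sym (+-suc k (k + 0))))

half-double : ∀ k → half (double k) ≡ k
half-double zero    = refl
half-double (suc k) = cong suc (half-double k)

double-half : ∀ n → isEven n ≡ true → double (half n) ≡ n
double-half zero          _    = refl
double-half (suc zero)    ()
double-half (suc (suc n)) even = cong (λ m → suc (suc m)) (double-half n (trans (sym (isEven-+2 n)) even))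

isEven-double : ∀ k → isEven (double k) ≡ true
isEven-double zero    = refl
isEven-double (suc k) = trans (isEven-+2 (double k)) (isEven-double k)

double-+ : ∀ a b → double (a + b) ≡ double a + double b
double-+ zero    b = refl
double-+ (suc a) b = cong (λ m → suc (suc m)) (double-+ a b)

double-injective : ∀ {a b} → double a ≡ double b → a ≡ b
double-injective {a} {b} eq = trans (sym (half-double a)) (trans (cong half eq) (half-double b))

double-sum : ∀ ks → double (sum ks) ≡ sum (map double ks)
double-sum []       = refl
double-sum (k ∷ ks) = trans (double-+ k (sum ks)) (cong (_+_ (double k)) (double-sum ks))

AllEven : List ℕ → Set
AllEven = All (λ d → isEven d ≡ true)

EvenBlock : Block → Set
EvenBlock ds = isEven (length ds) ≡ true × AllEven ds

indicator-not≡0 : ∀ b → indicator (not b) ≡ 0 → b ≡ true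
indicator-not≡0 true  _  = refl
indicator-not≡0 false ()

oddCount : List ℕ → ℕ
oddCount ds = sum (map (λ d → indicator (not (isEven d))) ds)

oddCount≡0⇒AllEven : ∀ ds → oddCount ds ≡ 0 → AllEven ds
oddCount≡0⇒AllEven []       _  = []
oddCount≡0⇒AllEven (d ∷ ds) eq = indicator-not≡0 (isEven d) (m+n≡0⇒m≡0 _ eq) ∷ oddCount≡0⇒AllEven ds (m+n≡0⇒n≡0 _ eq)

AllEven⇒oddCount≡0 : ∀ ds → AllEven ds → oddCount ds ≡ 0
AllEven⇒oddCount≡0 []       []            = refl
AllEven⇒oddCount≡0 (d ∷ ds) (even ∷ evens) rewrite even = AllEven⇒oddCount≡0 ds evens

noOddDegree⇒AllEvenBlock : ∀ w → blockCount oddDegree 0 w ≡ 0 → All EvenBlock w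
noOddDegree⇒AllEvenBlock []      _  = []
noOddDegree⇒AllEvenBlock (x ∷ w) eq =
  (indicator-not≡0 _ (m+n≡0⇒m≡0 _ block≡0) , oddCount≡0⇒AllEven x (m+n≡0⇒n≡0 _ block≡0)) ∷
  noOddDegree⇒AllEvenBlock w (m+n≡0⇒n≡0 _ eq)
  where block≡0 = m+n≡0⇒m≡0 _ eq

AllEvenBlock⇒noOddDegree : ∀ w → All EvenBlock w → blockCount oddDegree 0 w ≡ 0
AllEvenBlock⇒noOddDegree []      []                      = refl
AllEvenBlock⇒noOddDegree (x ∷ w) ((even , evens) ∷ rest) rewrite even | AllEven⇒oddCount≡0 x evens =
  AllEvenBlock⇒noOddDegree w rest

evenDegreeOddLevel-count : ∀ w → All EvenBlock w → blockCount evenDegreeOddLevel 0 w ≡ sum (map length w)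
evenDegreeOddLevel-count []      []                      = refl
evenDegreeOddLevel-count (x ∷ w) ((_ , evens) ∷ rest) =
  cong₂ _+_ (cong₂ _+_ (cong indicator (∧-zeroʳ (isEven (length x)))) (entries x evens)) (evenDegreeOddLevel-count w rest)
  where
    entries : ∀ ds → AllEven ds → sum (map (λ d → indicator (isEven d ∧ true)) ds) ≡ length ds
    entries []       []            = refl
    entries (d ∷ ds) (even ∷ evens) = cong₂ _+_ (cong indicator (trans (∧-identityʳ (isEven d)) even)) (entries ds evens)

evenDegreeEvenLevel-count : ∀ w → All EvenBlock w → blockCount evenDegreeEvenLevel 0 w ≡ length w
evenDegreeEvenLevel-count []      []                      = refl
evenDegreeEvenLevel-count (x ∷ w) ((even , _) ∷ rest) =
  cong₂ _+_ (cong₂ _+_ (cong indicator (trans (∧-identityʳ (isEven (length x))) even)) (entries x))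
            (evenDegreeEvenLevel-count w rest)
  where
    entries : ∀ ds → sum (map (λ d → indicator (isEven d ∧ false)) ds) ≡ 0
    entries []       = refl
    entries (d ∷ ds) = cong₂ _+_ (cong indicator (∧-zeroʳ (isEven d))) (entries ds)

-- A word of even blocks is determined by its halved block lengths and its halved entries.
halfLengths : List Block → List ℕ
halfLengths = map (λ ds → half (length ds))

halvedEntries : List Block → List ℕ
halvedEntries = concatMap (map half)

assemble : List ℕ → List ℕ → List Block
assemble []       bs = []
assemble (a ∷ as) bs = map double (take (double a) bs) ∷ assemble as (drop (double a) bs)

AllEven-map-double : ∀ ds → AllEven (map double ds)
AllEven-map-double []       = []
AllEven-map-double (d ∷ ds) = isEven-double d ∷ AllEven-map-double ds

double-sum-halfLengths : ∀ u → All EvenBlock u → double (sum (halfLengths u)) ≡ sum (map length u)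
double-sum-halfLengths []      []                  = refl
double-sum-halfLengths (x ∷ u) ((even , _) ∷ rest) =
  trans (double-+ (half (length x)) _) (cong₂ _+_ (double-half _ even) (double-sum-halfLengths u rest))

length-halvedEntries : ∀ u → length (halvedEntries u) ≡ sum (map length u)
length-halvedEntries []      = refl
length-halvedEntries (x ∷ u) = trans (length-++ (map half x)) (cong₂ _+_ (length-map half x) (length-halvedEntries u))

map-double-half : ∀ ds → AllEven ds → map double (map half ds) ≡ ds
map-double-half []       []            = refl
map-double-half (d ∷ ds) (even ∷ evens) = cong₂ _∷_ (double-half d even) (map-double-half ds evens)

map-half-double : ∀ ds → map half (map double ds) ≡ ds
map-half-double []       = refl
map-half-double (d ∷ ds) = cong₂ _∷_ (half-double d) (map-half-double ds)

double-sum-halvedEntries : ∀ u → All EvenBlock u → double (sum (halvedEntries u)) ≡ B.weight u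
double-sum-halvedEntries []      []                  = refl
double-sum-halvedEntries (x ∷ u) ((_ , evens) ∷ rest) = begin
  double (sum (map half x ++ halvedEntries u))                ≡⟨ cong double (sum-++ (map half x) _) ⟩
  double (sum (map half x) + sum (halvedEntries u))           ≡⟨ double-+ (sum (map half x)) _ ⟩
  double (sum (map half x)) + double (sum (halvedEntries u))  ≡⟨ cong₂ _+_ (double-sum (map half x)) (double-sum-halvedEntries u rest) ⟩
  sum (map double (map half x)) + B.weight u                  ≡⟨ cong (λ ds → sum ds + B.weight u) (map-double-half x evens) ⟩
  sum x + B.weight u                                          ∎
  where open ≡-Reasoning

assemble-halves : ∀ u → All EvenBlock u → assemble (halfLengths u) (halvedEntries u) ≡ u
assemble-halves []      []                      = refl
assemble-halves (x ∷ u) ((even , evens) ∷ rest) = cong₂ _∷_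
  (trans (cong (λ n → map double (take n (map half x ++ halvedEntries u))) split-point)
    (trans (cong (map double) (take-length-++ (map half x) (halvedEntries u))) (map-double-half x evens)))
  (trans (cong (λ n → assemble (halfLengths u) (drop n (map half x ++ halvedEntries u))) split-point)
    (trans (cong (assemble (halfLengths u)) (drop-length-++ (map half x) (halvedEntries u))) (assemble-halves u rest)))
  where
    split-point : double (half (length x)) ≡ length (map half x)
    split-point = trans (double-half _ even) (sym (length-map half x))

module _ (a : ℕ) (as bs : List ℕ) (length-bs : length bs ≡ double (sum (a ∷ as))) where
  double-a≤ : double a ≤ length bs
  double-a≤ = subst (double a ≤_) (sym (trans length-bs (double-+ a (sum as)))) (m≤m+n (double a) _)

  length-drop-double : length (drop (double a) bs) ≡ double (sum as)
  length-drop-double = trans (length-drop (double a) bs)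
    (trans (cong (_∸ double a) (trans length-bs (double-+ a (sum as)))) (m+n∸m≡n (double a) _))

  length-take-double : length (map double (take (double a) bs)) ≡ double a
  length-take-double = trans (length-map double (take (double a) bs)) (length-take-≤ (double a) bs double-a≤)

halfLengths-assemble : ∀ as bs → length bs ≡ double (sum as) → halfLengths (assemble as bs) ≡ as
halfLengths-assemble []       bs _  = refl
halfLengths-assemble (a ∷ as) bs eq =
  cong₂ _∷_ (trans (cong half (length-take-double a as bs eq)) (half-double a))
            (halfLengths-assemble as (drop (double a) bs) (length-drop-double a as bs eq))

halvedEntries-assemble : ∀ as bs → length bs ≡ double (sum as) → halvedEntries (assemble as bs) ≡ bs
halvedEntries-assemble []       []      _  = refl
halvedEntries-assemble []       (_ ∷ _) ()
halvedEntries-assemble (a ∷ as) bs      eq =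
  trans (cong₂ _++_ (map-half-double (take (double a) bs)) (halvedEntries-assemble as (drop (double a) bs) (length-drop-double a as bs eq)))
        (take++drop≡id (double a) bs)

assemble-even : ∀ as bs → length bs ≡ double (sum as) → All EvenBlock (assemble as bs)
assemble-even []       bs _  = []
assemble-even (a ∷ as) bs eq =
  (trans (cong isEven (length-take-double a as bs eq)) (isEven-double a) , AllEven-map-double (take (double a) bs)) ∷
  assemble-even as (drop (double a) bs) (length-drop-double a as bs eq)

length-assemble : ∀ as bs → length (assemble as bs) ≡ length as
length-assemble []       bs = refl
length-assemble (a ∷ as) bs = cong suc (length-assemble as (drop (double a) bs))

Shape : ℕ → ℕ → Tree → Set
Shape i j T = oddNodes T ≡ 0 × oe T ≡ 2 * i × ee T ≡ suc (2 * j)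

BlockShape : ℕ → ℕ → List Block → Set
BlockShape i j w =
  blockCount oddDegree 0 w ≡ 0 × blockCount evenDegreeOddLevel 0 w ≡ 2 * i × blockCount evenDegreeEvenLevel 0 w ≡ suc (2 * j)

≡-triple-↔ : ∀ {a a′ b b′ c c′ x y z : ℕ} → a ≡ a′ → b ≡ b′ → c ≡ c′ →
             (a ≡ x × b ≡ y × c ≡ z) ↔ (a′ ≡ x × b′ ≡ y × c′ ≡ z)
≡-triple-↔ refl refl refl = ↔-refl

≡-triple-irrelevant : ∀ {a b c x y z : ℕ} → Irrelevant (a ≡ x × b ≡ y × c ≡ z)
≡-triple-irrelevant (p , q , r) (p′ , q′ , r′) = cong₂ _,_ (≡-irrelevant p p′) (cong₂ _,_ (≡-irrelevant q q′) (≡-irrelevant r r′))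

Shape↔BlockShape : ∀ i j T → Shape i j T ↔ BlockShape i j (B.encode (toBlocks T))
Shape↔BlockShape i j T = ≡-triple-↔
  (countT≡blockCount oddDegree oddDegree-periodic 0 T)
  (countT≡blockCount evenDegreeOddLevel evenDegreeOddLevel-periodic 0 T)
  (countT≡blockCount evenDegreeEvenLevel evenDegreeEvenLevel-periodic 0 T)

BlockShape-rotate : ∀ i j u v → BlockShape i j (u ++ v) → BlockShape i j (v ++ u)
BlockShape-rotate i j u v = Inverse.to (≡-triple-↔ (swap oddDegree) (swap evenDegreeOddLevel) (swap evenDegreeEvenLevel))
  where swap = λ P → blockCount-swap P 0 u v

module BlockRotations (i j : ℕ) =
  B.Rotations (BlockShape i j) (BlockShape-rotate i j) ≡-triple-irrelevant (suc (2 * j))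

module _ (i j : ℕ) where
  open BlockRotations i j

  ShapedTree↔ValidWord : Σ Tree (Shape i j) ↔ ValidWord
  ShapedTree↔ValidWord = ↔-trans (Σ-↔ Tree↔BlockTree (λ {T} → Shape↔BlockShape i j T)) (ΣLTree↔ValidWord (λ {w} → length-E {w}))
    where
      length-E : ∀ {w} → BlockShape i j w → length w ≡ suc (2 * j)
      length-E {w} (noOdd , _ , evenCount) = trans (sym (evenDegreeEvenLevel-count w (noOddDegree⇒AllEvenBlock w noOdd))) evenCount

  -- The ee = 2j + 1 blocks have half-lengths summing to i, and the 2i halved entries sum to j.
  BalancedWord↔Compositions : BalancedWord ↔ (Composition (suc (2 * j)) i × Composition (2 * i) j)
  BalancedWord↔Compositions = mk↔ₛ′ halve double-up halve-double-up double-up-halve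
    where
      halve : BalancedWord → Composition (suc (2 * j)) i × Composition (2 * i) j
      halve (u , balanced , length-u , (noOdd , oddLevel , _)) =
        (halfLengths u , trans (length-map _ u) length-u , double-injective halfLengths-sum) ,
        (halvedEntries u , trans (length-halvedEntries u) entries≡2i , double-injective halvedEntries-sum)
        where
          even = noOddDegree⇒AllEvenBlock u noOdd
          entries≡2i : sum (map length u) ≡ 2 * i
          entries≡2i = trans (sym (evenDegreeOddLevel-count u even)) oddLevel
          halfLengths-sum : double (sum (halfLengths u)) ≡ double i
          halfLengths-sum = trans (double-sum-halfLengths u even) (trans entries≡2i (sym (double≡2* i)))
          halvedEntries-sum : double (sum (halvedEntries u)) ≡ double j
          halvedEntries-sum = trans (double-sum-halvedEntries u even) (trans (suc-injective (trans balanced length-u)) (sym (double≡2* j)))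

      double-up : Composition (suc (2 * j)) i × Composition (2 * i) j → BalancedWord
      double-up ((as , length-as , sum-as) , (bs , length-bs , sum-bs)) =
        u , trans (cong suc (trans weight-u (double≡2* j))) (sym length-u) , length-u ,
        (AllEvenBlock⇒noOddDegree u even , oddLevel-u , trans (evenDegreeEvenLevel-count u even) length-u)
        where
          fits : length bs ≡ double (sum as)
          fits = trans length-bs (trans (sym (double≡2* i)) (cong double (sym sum-as)))
          u = assemble as bs
          even = assemble-even as bs fits
          weight-u : B.weight u ≡ double j
          weight-u = trans (sym (double-sum-halvedEntries u even)) (cong double (trans (cong sum (halvedEntries-assemble as bs fits)) sum-bs))
          length-u : length u ≡ suc (2 * j)
          length-u = trans (length-assemble as bs) length-as
          oddLevel-u : blockCount evenDegreeOddLevel 0 u ≡ 2 * i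
          oddLevel-u = trans (evenDegreeOddLevel-count u even) (trans (sym (double-sum-halfLengths u even))
            (trans (cong double (trans (cong sum (halfLengths-assemble as bs fits)) sum-as)) (double≡2* i)))

      halve-double-up : ∀ y → halve (double-up y) ≡ y
      halve-double-up ((as , length-as , sum-as) , (bs , length-bs , sum-bs)) =
        cong₂ _,_ (Composition-≡ (halfLengths-assemble as bs fits)) (Composition-≡ (halvedEntries-assemble as bs fits))
        where fits = trans length-bs (trans (sym (double≡2* i)) (cong double (sym sum-as)))

      double-up-halve : ∀ x → double-up (halve x) ≡ x
      double-up-halve (u , _ , _ , (noOdd , _ , _)) = BalancedWord-≡ (assemble-halves u (noOddDegree⇒AllEvenBlock u noOdd))

  shapedTreeCount : Σ ℕ λ N → (Σ Tree (Shape i j) ↔ Fin N) ×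
                    N * suc (2 * j) ≡ compositionCount (suc (2 * j)) i * compositionCount (2 * i) j
  shapedTreeCount =
    let N , trees↔ , N*E≡ = ×-Fin↔Fin⇒↔Fin (2 * j) _ (↔-trans rotations↔ (↔-trans BalancedWord↔Compositions
                              (↔-trans (Composition↔Fin _ _ ×-↔ Composition↔Fin _ _) (↔-sym *↔×))))
    in N , ↔-trans ShapedTree↔ValidWord trees↔ , N*E≡

-- Trees without odd-degree nodes, by size

module L = Labelled {ℕ} (λ d → d)

mutual
  toŁukasiewicz : Tree → L.LTree
  toŁukasiewicz (node ts) = L.node (length ts) (toŁukasiewiczForest ts) (length-toŁukasiewiczForest ts)

  toŁukasiewiczForest : List Tree → List L.LTree
  toŁukasiewiczForest []       = []
  toŁukasiewiczForest (t ∷ ts) = toŁukasiewicz t ∷ toŁukasiewiczForest ts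

  length-toŁukasiewiczForest : ∀ ts → length (toŁukasiewiczForest ts) ≡ length ts
  length-toŁukasiewiczForest []       = refl
  length-toŁukasiewiczForest (t ∷ ts) = cong suc (length-toŁukasiewiczForest ts)

mutual
  fromŁukasiewicz : L.LTree → Tree
  fromŁukasiewicz (L.node _ ts _) = node (fromŁukasiewiczForest ts)

  fromŁukasiewiczForest : List L.LTree → List Tree
  fromŁukasiewiczForest []       = []
  fromŁukasiewiczForest (t ∷ ts) = fromŁukasiewicz t ∷ fromŁukasiewiczForest ts

length-fromŁukasiewiczForest : ∀ ts → length (fromŁukasiewiczForest ts) ≡ length ts
length-fromŁukasiewiczForest []       = refl
length-fromŁukasiewiczForest (t ∷ ts) = cong suc (length-fromŁukasiewiczForest ts)

mutual
  from-toŁukasiewicz : ∀ t → fromŁukasiewicz (toŁukasiewicz t) ≡ t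
  from-toŁukasiewicz (node ts) = cong node (from-toŁukasiewiczForest ts)

  from-toŁukasiewiczForest : ∀ ts → fromŁukasiewiczForest (toŁukasiewiczForest ts) ≡ ts
  from-toŁukasiewiczForest []       = refl
  from-toŁukasiewiczForest (t ∷ ts) = cong₂ _∷_ (from-toŁukasiewicz t) (from-toŁukasiewiczForest ts)

mutual
  to-fromŁukasiewicz : ∀ t → toŁukasiewicz (fromŁukasiewicz t) ≡ t
  to-fromŁukasiewicz (L.node d ts p) = L.node-cong (trans (length-fromŁukasiewiczForest ts) p) (to-fromŁukasiewiczForest ts)

  to-fromŁukasiewiczForest : ∀ ts → toŁukasiewiczForest (fromŁukasiewiczForest ts) ≡ ts
  to-fromŁukasiewiczForest []       = refl
  to-fromŁukasiewiczForest (t ∷ ts) = cong₂ _∷_ (to-fromŁukasiewicz t) (to-fromŁukasiewiczForest ts)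

Tree↔LTree : Tree ↔ L.LTree
Tree↔LTree = mk↔ₛ′ toŁukasiewicz fromŁukasiewicz to-fromŁukasiewicz from-toŁukasiewicz

degreeCount : (ℕ → Bool) → List ℕ → ℕ
degreeCount p w = sum (map (λ d → indicator (p d)) w)

degreeCount-++ : ∀ p u v → degreeCount p (u ++ v) ≡ degreeCount p u + degreeCount p v
degreeCount-++ p u v = trans (cong sum (map-++ _ u v)) (sum-++ (map (λ d → indicator (p d)) u) _)

mutual
  countT≡degreeCount : ∀ p l t → countT (λ _ d → p d) l t ≡ degreeCount p (L.encode (toŁukasiewicz t))
  countT≡degreeCount p l (node ts) = cong (_+_ (indicator (p (length ts)))) (countF≡degreeCount p (suc l) ts)

  countF≡degreeCount : ∀ p l ts → countF (λ _ d → p d) l ts ≡ degreeCount p (L.encodeForest (toŁukasiewiczForest ts))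
  countF≡degreeCount p l []       = refl
  countF≡degreeCount p l (t ∷ ts) =
    trans (cong₂ _+_ (countT≡degreeCount p l t) (countF≡degreeCount p l ts))
          (sym (degreeCount-++ p (L.encode (toŁukasiewicz t)) _))

degreeCount-true : ∀ w → degreeCount (λ _ → true) w ≡ length w
degreeCount-true []      = refl
degreeCount-true (d ∷ w) = cong suc (degreeCount-true w)

size : Tree → ℕ
size = countT (λ _ _ → true) 0

EvenTree : ℕ → Tree → Set
EvenTree n T = oddNodes T ≡ 0 × size T ≡ suc (2 * n)

EvenWord : ℕ → List ℕ → Set
EvenWord n w = oddCount w ≡ 0 × length w ≡ suc (2 * n)

≡-pair-↔ : ∀ {a a′ b b′ x y : ℕ} → a ≡ a′ → b ≡ b′ → (a ≡ x × b ≡ y) ↔ (a′ ≡ x × b′ ≡ y)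
≡-pair-↔ refl refl = ↔-refl

EvenTree↔EvenWord : ∀ n T → EvenTree n T ↔ EvenWord n (L.encode (toŁukasiewicz T))
EvenTree↔EvenWord n T = ≡-pair-↔ (countT≡degreeCount (λ d → not (isEven d)) 0 T)
  (trans (countT≡degreeCount (λ _ → true) 0 T) (degreeCount-true (L.encode (toŁukasiewicz T))))

EvenWord-rotate : ∀ n u v → EvenWord n (u ++ v) → EvenWord n (v ++ u)
EvenWord-rotate n u v = Inverse.to (≡-pair-↔ (degreeCount-swap _) (length-swap u v))
  where
    degreeCount-swap : ∀ p → degreeCount p (u ++ v) ≡ degreeCount p (v ++ u)
    degreeCount-swap p = trans (degreeCount-++ p u v) (trans (+-comm (degreeCount p u) _) (sym (degreeCount-++ p v u)))

EvenWord-irrelevant : ∀ n {w} → Irrelevant (EvenWord n w)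
EvenWord-irrelevant n (p , q) (p′ , q′) = cong₂ _,_ (≡-irrelevant p p′) (≡-irrelevant q q′)

module WordRotations (n : ℕ) = L.Rotations (EvenWord n) (EvenWord-rotate n) (λ {w} → EvenWord-irrelevant n {w}) (suc (2 * n))

module _ (n : ℕ) where
  open WordRotations n

  EvenTree↔ValidWord : Σ Tree (EvenTree n) ↔ ValidWord
  EvenTree↔ValidWord = ↔-trans (Σ-↔ Tree↔LTree (λ {T} → EvenTree↔EvenWord n T)) (ΣLTree↔ValidWord proj₂)

  BalancedWord↔Composition : BalancedWord ↔ Composition (suc (2 * n)) n
  BalancedWord↔Composition = mk↔ₛ′ halve double-up halve-double-up double-up-halve
    where
      weight≡sum : ∀ u → L.weight u ≡ sum u
      weight≡sum u = cong sum (map-id u)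

      halve : BalancedWord → Composition (suc (2 * n)) n
      halve (u , balanced , length-u , (noOdd , _)) =
        map half u , trans (length-map half u) length-u ,
        double-injective (begin
          double (sum (map half u))     ≡⟨ double-sum (map half u) ⟩
          sum (map double (map half u)) ≡⟨ cong sum (map-double-half u (oddCount≡0⇒AllEven u noOdd)) ⟩
          sum u                         ≡⟨ weight≡sum u ⟨
          L.weight u                    ≡⟨ suc-injective (trans balanced length-u) ⟩
          2 * n                         ≡⟨ double≡2* n ⟨
          double n                      ∎)
        where open ≡-Reasoning

      double-up : Composition (suc (2 * n)) n → BalancedWord
      double-up (x , length-x , sum-x) =
        map double x , trans (cong suc weight-u) (sym length-u) , length-u ,
        (AllEven⇒oddCount≡0 (map double x) (AllEven-map-double x) , length-u)
        where
          length-u = trans (length-map double x) length-x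
          weight-u : L.weight (map double x) ≡ 2 * n
          weight-u = trans (weight≡sum (map double x)) (trans (sym (double-sum x)) (trans (cong double sum-x) (double≡2* n)))

      halve-double-up : ∀ y → halve (double-up y) ≡ y
      halve-double-up (x , _ , _) = Composition-≡ (map-half-double x)

      double-up-halve : ∀ x → double-up (halve x) ≡ x
      double-up-halve (u , _ , _ , (noOdd , _)) = BalancedWord-≡ (map-double-half u (oddCount≡0⇒AllEven u noOdd))

  evenTreeCount : Σ ℕ λ N → (Σ Tree (EvenTree n) ↔ Fin N) × N * suc (2 * n) ≡ compositionCount (suc (2 * n)) n
  evenTreeCount =
    let N , trees↔ , N*E≡ = ×-Fin↔Fin⇒↔Fin (2 * n) _
                              (↔-trans rotations↔ (↔-trans BalancedWord↔Composition (Composition↔Fin _ _)))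
    in N , ↔-trans EvenTree↔ValidWord trees↔ , N*E≡

-- Splitting by ee

mutual
  countT-+ : ∀ P Q R → (∀ l d → indicator (P l d) + indicator (Q l d) ≡ indicator (R l d)) →
             ∀ l t → countT P l t + countT Q l t ≡ countT R l t
  countT-+ P Q R pointwise l (node ts) =
    trans (+-interchange (indicator (P l (length ts))) _ _ _) (cong₂ _+_ (pointwise l (length ts)) (countF-+ P Q R pointwise (suc l) ts))

  countF-+ : ∀ P Q R → (∀ l d → indicator (P l d) + indicator (Q l d) ≡ indicator (R l d)) →
             ∀ l ts → countF P l ts + countF Q l ts ≡ countF R l ts
  countF-+ P Q R pointwise l []       = refl
  countF-+ P Q R pointwise l (t ∷ ts) =
    trans (+-interchange (countT P l t) _ _ _) (cong₂ _+_ (countT-+ P Q R pointwise l t) (countF-+ P Q R pointwise l ts))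

size≡ : ∀ T → oddNodes T + (oe T + ee T) ≡ size T
size≡ T = trans (cong (_+_ (oddNodes T)) (countT-+ evenDegreeOddLevel evenDegreeEvenLevel (λ _ d → isEven d) byLevel 0 T))
                (countT-+ oddDegree (λ _ d → isEven d) (λ _ _ → true) byParity 0 T)
  where
    byLevel : ∀ l d → indicator (isEven d ∧ not (isEven l)) + indicator (isEven d ∧ isEven l) ≡ indicator (isEven d)
    byLevel l d with isEven d | isEven l
    ... | true  | true  = refl
    ... | true  | false = refl
    ... | false | _     = refl
    byParity : ∀ l d → indicator (not (isEven d)) + indicator (isEven d) ≡ 1
    byParity l d with isEven d
    ... | true  = refl
    ... | false = refl

oe+ee≡size : ∀ T → oddNodes T ≡ 0 → oe T + ee T ≡ size T
oe+ee≡size T noOdd = trans (cong (_+ (oe T + ee T)) (sym noOdd)) (size≡ T)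

-- The odd-level nodes are the entries of the blocks, and every block has even length.
oe-even : ∀ T → oddNodes T ≡ 0 → Σ ℕ λ k → oe T ≡ double k
oe-even T noOdd = sum (halfLengths w) ,
  trans (countT≡blockCount evenDegreeOddLevel evenDegreeOddLevel-periodic 0 T)
        (trans (evenDegreeOddLevel-count w even) (sym (double-sum-halfLengths w even)))
  where
    w = B.encode (toBlocks T)
    even = noOddDegree⇒AllEvenBlock w (trans (sym (countT≡blockCount oddDegree oddDegree-periodic 0 T)) noOdd)

double+odd : ∀ k e n → double k + e ≡ suc (double n) → k ≤ n × e ≡ suc (double (n ∸ k))
double+odd zero    e n       eq = z≤n , eq
double+odd (suc k) e zero    ()
double+odd (suc k) e (suc n) eq with k≤n , e≡ ← double+odd k e n (suc-injective (suc-injective eq)) = s≤s k≤n , e≡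

2*[n∸j]+[2*j+1]≡2*n+1 : ∀ n j → j ≤ n → 2 * (n ∸ j) + suc (2 * j) ≡ suc (2 * n)
2*[n∸j]+[2*j+1]≡2*n+1 n j j≤n =
  trans (+-suc (2 * (n ∸ j)) (2 * j)) (cong suc (trans (sym (*-distribˡ-+ 2 (n ∸ j) j)) (cong (2 *_) (m∸n+n≡m j≤n))))

EvenTree↔ΣShape : ∀ n → Σ Tree (EvenTree n) ↔ Σ (Fin (suc n)) (λ j → Σ Tree (Shape (n ∸ toℕ j) (toℕ j)))
EvenTree↔ΣShape n = mk↔ₛ′ split merge split-merge merge-split
  where
    split : Σ Tree (EvenTree n) → Σ (Fin (suc n)) (λ j → Σ Tree (Shape (n ∸ toℕ j) (toℕ j)))
    split (T , noOdd , size-T) = j , T , noOdd , oe≡ , ee≡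
      where
        k = proj₁ (oe-even T noOdd)
        oe≡double-k = proj₂ (oe-even T noOdd)
        bounds = double+odd k (ee T) n (begin
          double k + ee T  ≡⟨ cong (_+ ee T) oe≡double-k ⟨
          oe T + ee T      ≡⟨ oe+ee≡size T noOdd ⟩
          size T           ≡⟨ size-T ⟩
          suc (2 * n)      ≡⟨ cong suc (double≡2* n) ⟨
          suc (double n)   ∎)
          where open ≡-Reasoning
        j : Fin (suc n)
        j = fromℕ< (s≤s (m∸n≤m n k))
        toℕ-j : toℕ j ≡ n ∸ k
        toℕ-j = toℕ-fromℕ< _
        oe≡ : oe T ≡ 2 * (n ∸ toℕ j)
        oe≡ = trans oe≡double-k (trans (double≡2* k) (cong (2 *_) (sym (trans (cong (n ∸_) toℕ-j) (m∸[m∸n]≡n (proj₁ bounds))))))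
        ee≡ : ee T ≡ suc (2 * toℕ j)
        ee≡ = trans (proj₂ bounds) (cong suc (trans (double≡2* (n ∸ k)) (cong (2 *_) (sym toℕ-j))))

    merge : Σ (Fin (suc n)) (λ j → Σ Tree (Shape (n ∸ toℕ j) (toℕ j))) → Σ Tree (EvenTree n)
    merge (j , T , noOdd , oe≡ , ee≡) =
      T , noOdd , trans (sym (oe+ee≡size T noOdd)) (trans (cong₂ _+_ oe≡ ee≡) (2*[n∸j]+[2*j+1]≡2*n+1 n (toℕ j) (s≤s⁻¹ (toℕ<n j))))

    split-merge : ∀ x → split (merge x) ≡ x
    split-merge (j , T , noOdd , oe≡ , ee≡) = Σ-Shape-≡ (toℕ-injective (trans (toℕ-fromℕ< _) n∸k≡j))
      where
        k = proj₁ (oe-even T noOdd)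
        k≡ : k ≡ n ∸ toℕ j
        k≡ = double-injective (trans (sym (proj₂ (oe-even T noOdd))) (trans oe≡ (sym (double≡2* _))))
        n∸k≡j : n ∸ k ≡ toℕ j
        n∸k≡j = trans (cong (n ∸_) k≡) (m∸[m∸n]≡n (s≤s⁻¹ (toℕ<n j)))
        Σ-Shape-≡ : ∀ {j′} {s : Shape (n ∸ toℕ j′) (toℕ j′) T} → j′ ≡ j →
                    _≡_ {A = Σ (Fin (suc n)) (λ j → Σ Tree (Shape (n ∸ toℕ j) (toℕ j)))} (j′ , T , s) (j , T , noOdd , oe≡ , ee≡)
        Σ-Shape-≡ refl = cong (λ s → j , T , s) (≡-triple-irrelevant _ _)

    merge-split : ∀ x → merge (split x) ≡ x
    merge-split (T , noOdd , size-T) = cong (λ s → T , noOdd , s) (≡-irrelevant _ _)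

shapedCount : ℕ → ℕ → ℕ
shapedCount i j = proj₁ (shapedTreeCount i j)

evenCount : ℕ → ℕ
evenCount n = proj₁ (evenTreeCount n)

shapedCount-formula : ∀ i j → shapedCount i j * suc (2 * j) ≡ ((2 * j + i) C i) * binomPred (2 * i + j) j
shapedCount-formula i j = trans (proj₂ (proj₂ (shapedTreeCount i j)))
  (cong₂ _*_ (compositionCount≡binomPred (suc (2 * j)) i) (compositionCount≡binomPred (2 * i) j))

evenCount-formula : ∀ n → evenCount n * suc (2 * n) ≡ (3 * n) C n
evenCount-formula n = trans (proj₂ (proj₂ (evenTreeCount n)))
  (trans (compositionCount≡binomPred (suc (2 * n)) n) (cong (_C n) (2*n+n≡3*n n)))
  where
    2*n+n≡3*n : ∀ n → 2 * n + n ≡ 3 * n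
    2*n+n≡3*n = solve-∀

evenCount≡sum : ∀ n → evenCount n ≡ sum (applyUpTo (λ j → shapedCount (n ∸ j) j) (suc n))
evenCount≡sum n = ↔⇒≡ (↔-trans (↔-sym (proj₁ (proj₂ (evenTreeCount n))))
  (↔-trans (EvenTree↔ΣShape n)
    (↔-trans (Σ-↔ ↔-refl (λ {j} → proj₁ (proj₂ (shapedTreeCount (n ∸ toℕ j) (toℕ j)))))
      (Σ-Fin↔Fin-sum (suc n) (λ j → shapedCount (n ∸ j) j)))))

[m*n]/n≡m/1 : ∀ m n → (+ (m * suc n)) / suc n ≡ (+ m) / 1
[m*n]/n≡m/1 m n = fromℚᵘ-cong {mkℚᵘ (+ (m * suc n)) n} {mkℚᵘ (+ m) 0}
  (*≡* (trans (sym (ℤ.pos-* (m * suc n) 1)) (trans (cong +_ (*-identityʳ _)) (ℤ.pos-* m (suc n)))))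

[m+n]/1≡m/1+n/1 : ∀ m n → (+ (m + n)) / 1 ≡ (+ m) / 1 +ℚ (+ n) / 1
[m+n]/1≡m/1+n/1 m n = toℚᵘ-injective (begin
  toℚᵘ ((+ (m + n)) / 1)              ≈⟨ toℚᵘ-fromℚᵘ (mkℚᵘ (+ (m + n)) 0) ⟩
  mkℚᵘ (+ (m + n)) 0                  ≈⟨ *≡* integral ⟩
  mkℚᵘ (+ m) 0 +ᵘ mkℚᵘ (+ n) 0        ≈⟨ ℚᵘ.+-cong (toℚᵘ-fromℚᵘ (mkℚᵘ (+ m) 0)) (toℚᵘ-fromℚᵘ (mkℚᵘ (+ n) 0)) ⟨
  toℚᵘ ((+ m) / 1) +ᵘ toℚᵘ ((+ n) / 1) ≈⟨ toℚᵘ-homo-+ ((+ m) / 1) ((+ n) / 1) ⟨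
  toℚᵘ ((+ m) / 1 +ℚ (+ n) / 1)       ∎)
  where
    open ℚᵘ.≃-Reasoning
    integral = trans (ℤ.*-identityʳ (+ (m + n))) (trans (ℤ.pos-+ m n)
      (sym (trans (ℤ.*-identityʳ _) (cong₂ _+ℤ_ (ℤ.*-identityʳ (+ m)) (ℤ.*-identityʳ (+ n))))))

sum/1≡foldr : ∀ n (g : ℕ → ℕ) → (+ sum (applyUpTo g n)) / 1 ≡ foldr _+ℚ_ 0ℚ (applyUpTo (λ j → (+ g j) / 1) n)
sum/1≡foldr zero    g = refl
sum/1≡foldr (suc n) g = trans ([m+n]/1≡m/1+n/1 (g 0) _) (cong ((+ g 0) / 1 +ℚ_) (sum/1≡foldr n (λ j → g (suc j))))

binomial-reindex : ∀ n j → j < n →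
  ((2 * j + (n ∸ j)) C (n ∸ j)) * binomPred (2 * (n ∸ j) + j) j ≡ ((n + j) C (2 * j)) * ((2 * n ∸ j ∸ 1) C j)
-- Abstracting t = n ∸ suc j rewrites n to suc (j + t).
binomial-reindex n j j<n with n ∸ suc j | m+[n∸m]≡n j<n
... | t | refl rewrite trans (cong (_∸ j) (sym (+-suc j t))) (m+n∸m≡n j (suc t)) = cong₂ _*_ first second
  where
    first : (2 * j + suc t) C suc t ≡ (suc (j + t) + j) C (2 * j)
    first = trans (nCk≡nC[n∸k] (m≤n+m (suc t) (2 * j)))
      (trans (cong ((2 * j + suc t) C_) (m+n∸n≡m (2 * j) (suc t))) (cong (_C (2 * j)) (lhs≡ j t)))
      where
        lhs≡ : ∀ j t → 2 * j + suc t ≡ suc (j + t) + j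
        lhs≡ = solve-∀
    second : ((t + suc (t + 0)) + j) C j ≡ (2 * suc (j + t) ∸ j ∸ 1) C j
    second = cong (λ m → (m ∸ 1) C j) (sym (trans (cong (_∸ j) (rhs≡ j t)) (m+n∸m≡n j _)))
      where
        rhs≡ : ∀ j t → 2 * suc (j + t) ≡ j + suc ((t + suc (t + 0)) + j)
        rhs≡ = solve-∀

shapedCount-ℚ : ∀ i j → (+ shapedCount i j) / 1 ≡ (+ (((2 * j + i) C i) * binomPred (2 * i + j) j)) / suc (2 * j)
shapedCount-ℚ i j = trans (sym ([m*n]/n≡m/1 (shapedCount i j) (2 * j))) (cong (λ m → (+ m) / suc (2 * j)) (shapedCount-formula i j))

-- With no even-degree node on odd levels, the root is a leaf; so ee = 1.
shapedCount-0-suc : ∀ m → shapedCount 0 (suc m) ≡ 0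
shapedCount-0-suc m = m*n≡0⇒m≡0 (shapedCount 0 (suc m)) (suc (2 * suc m))
  (trans (shapedCount-formula 0 (suc m)) (trans (cong (((2 * suc m + 0) C 0) *_) (k>n⇒nCk≡0 (n<1+n m))) (*-zeroʳ ((2 * suc m + 0) C 0))))

[3n]Cn/[2n+1]≡sum : (n : ℕ) → n ≥ 1 →
  (+ ((3 * n) C n)) / suc (2 * n) ≡ sumℚ n (λ j → (+ (((n + j) C (2 * j)) * ((2 * n ∸ j ∸ 1) C j))) / suc (2 * j))
[3n]Cn/[2n+1]≡sum n@(suc m) _ = begin
  (+ ((3 * n) C n)) / suc (2 * n)                        ≡⟨ cong (λ x → (+ x) / suc (2 * n)) (evenCount-formula n) ⟨
  (+ (evenCount n * suc (2 * n))) / suc (2 * n)          ≡⟨ [m*n]/n≡m/1 (evenCount n) (2 * n) ⟩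
  (+ evenCount n) / 1                                    ≡⟨ cong (λ x → (+ x) / 1) evenCount≡ ⟩
  (+ sum (applyUpTo g n)) / 1                            ≡⟨ sum/1≡foldr n g ⟩
  foldr _+ℚ_ 0ℚ (applyUpTo (λ j → (+ g j) / 1) n)        ≡⟨ cong (foldr _+ℚ_ 0ℚ) (applyUpTo-cong n term≡) ⟩
  foldr _+ℚ_ 0ℚ (applyUpTo f n)                          ≡⟨ cong (foldr _+ℚ_ 0ℚ) (map-upTo f n) ⟨
  sumℚ n f                                               ∎
  where
    open ≡-Reasoning
    g : ℕ → ℕ
    g j = shapedCount (n ∸ j) j
    f : ℕ → ℚ
    f j = (+ (((n + j) C (2 * j)) * ((2 * n ∸ j ∸ 1) C j))) / suc (2 * j)
    evenCount≡ : evenCount n ≡ sum (applyUpTo g n)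
    evenCount≡ = trans (evenCount≡sum n) (trans (sum-applyUpTo-suc n g)
      (trans (cong (λ c → sum (applyUpTo g n) + c) (trans (cong (λ i → shapedCount i n) (n∸n≡0 n)) (shapedCount-0-suc m)))
        (+-identityʳ _)))
    term≡ : ∀ j → j < n → (+ g j) / 1 ≡ f j
    term≡ j j<n = trans (shapedCount-ℚ (n ∸ j) j) (cong (λ x → (+ x) / suc (2 * j)) (binomial-reindex n j j<n))

corollary3p7 : ((i j : ℕ) →
    Σ ℕ (λ N →
    (Σ Tree (λ T → (oddNodes T ≡ 0) × (oe T ≡ 2 * i) × (ee T ≡ suc (2 * j))) ↔ Fin N)
    × ((+ N) / 1 ≡ (+ (((2 * j + i) C i) * binomPred (2 * i + j) j)) / suc (2 * j))))
    ×
    ((n : ℕ) → n ≥ 1 →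
    (+ ((3 * n) C n)) / suc (2 * n)
    ≡ sumℚ n (λ j → (+ (((n + j) C (2 * j)) * ((2 * n ∸ j ∸ 1) C j))) / suc (2 * j)))
corollary3p7 = (λ i j → shapedCount i j , proj₁ (proj₂ (shapedTreeCount i j)) , shapedCount-ℚ i j) , [3n]Cn/[2n+1]≡sum
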